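{- For all integers $k\geq 2$ and $i\geq 0$, \[M_{i,k}(x)=M_{i,k}(x)\cdot\frac{T_k(x)^{k-1}}{(k-1)!}+R_{i,k}(x).\]
   Context: For $k\geq 2$, a $k$-phylogenetic tree on leaf set $[n]=\{1,\dots,n\}$ is a rooted non-plane tree whose leaves are bijectively labeled by $[n]$ and in which every non-leaf vertex has exactly $k$ children. The rank of a vertex is its distance to its closest descendant leaf. Let $t_{k,n}$ be the number of such trees ($t_{k,0}=0$), $m_{i,k}(n)$ the total number of vertices of rank at least $i$ over all such trees on leaf set $[n]$, and $r_{i,k}(n)$ the number of such trees on leaf set $[n]$ whose root has rank at least $i$ (all these are $0$ for $n=0$). Let $T_k(x)$, $M_{i,k}(x)$, $R_{i,k}(x)$ be the exponential generating functions $\sum_n a_n x^n/n!$ of $t_{k,n}$, $m_{i,k}(n)$, $r_{i,k}(n)$ respectively. -}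

module Defs where

open import Data.Nat as ℕ using (ℕ; zero; suc; _⊓_; _<ᵇ_; _≡ᵇ_; _∸_; _!; _≤_)
open import Data.Nat.Properties using (_!≢0)
open import Data.Fin as Fin using (Fin; toℕ; _≟_)
open import Data.Vec as Vec using (Vec; []; _∷_; lookup)
open import Data.List as List using (List; []; _∷_; _++_; map; foldr; allFin; upTo; zipWith; drop; filter; length)
open import Data.Bool using (Bool; true; false; _∧_)
open import Data.Bool.ListAction using (and; all)
open import Data.Product using (Σ; _×_)
open import Data.Integer using (+_)
open import Data.Rational as ℚ using (ℚ; 0ℚ; 1ℚ)
open import Relation.Binary.PropositionalEquality using (_≡_)

-- Non-plane trees are
-- represented by their unique canonical plane representative in which the
-- children of every internal vertex are listed in strictly increasing
-- order of their minimal leaf label (since leaf labels are distinct, the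
-- children of a vertex have disjoint nonempty leaf sets, so this is a
-- bijection between non-plane trees and canonical plane trees).

data PTree (k n : ℕ) : Set where
  leaf : Fin n → PTree k n
  node : Vec (PTree k n) k → PTree k n

module _ {k n : ℕ} where

  mutual
    leaves : PTree k n → List (Fin n)
    leaves (leaf x)  = x ∷ []
    leaves (node cs) = leavesV cs

    leavesV : ∀ {j} → Vec (PTree k n) j → List (Fin n)
    leavesV []       = []
    leavesV (c ∷ cs) = leaves c ++ leavesV cs

  -- minimal leaf label (n plays the role of +∞, all labels are < n)
  minLabel : PTree k n → ℕ
  minLabel T = foldr _⊓_ n (map toℕ (leaves T))

  increasing : List ℕ → Bool
  increasing xs = and (zipWith _<ᵇ_ xs (drop 1 xs))

  mutual
    canonical : PTree k n → Bool
    canonical (leaf x)  = true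
    canonical (node cs) = canonicalV cs ∧ increasing (map minLabel (Vec.toList cs))

    canonicalV : ∀ {j} → Vec (PTree k n) j → Bool
    canonicalV []       = true
    canonicalV (c ∷ cs) = canonical c ∧ canonicalV cs

  mutual
    rank : PTree k n → ℕ
    rank (leaf x)        = 0
    rank (node [])       = 0   -- irrelevant: only occurs for k = 0
    rank (node (c ∷ cs)) = suc (minRank (rank c) cs)

    minRank : ∀ {j} → ℕ → Vec (PTree k n) j → ℕ
    minRank acc []       = acc
    minRank acc (d ∷ ds) = minRank (acc ⊓ rank d) ds

  occ : Fin n → PTree k n → ℕ
  occ x T = length (filter (x ≟_) (leaves T))

  bijLabelled : PTree k n → Bool
  bijLabelled T = all (λ x → occ x T ≡ᵇ 1) (allFin n)

  data Pos : PTree k n → Set where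
    here  : ∀ {T} → Pos T
    there : ∀ {cs} (j : Fin k) → Pos (lookup cs j) → Pos (node cs)

  subtree : (T : PTree k n) → Pos T → PTree k n
  subtree T here               = T
  subtree (node cs) (there j p) = subtree (lookup cs j) p

PhyloTree : ℕ → ℕ → Set
PhyloTree k n = Σ (PTree k n) (λ T → (bijLabelled T ∧ canonical T) ≡ true)

RankVertex : ℕ → ℕ → ℕ → Set
RankVertex i k n =
  Σ (PhyloTree k n) (λ T → Σ (Pos (Σ.proj₁ T)) (λ v → i ≤ rank (subtree (Σ.proj₁ T) v)))

RankRoot : ℕ → ℕ → ℕ → Set
RankRoot i k n = Σ (PhyloTree k n) (λ T → i ≤ rank (Σ.proj₁ T))

PS : Set
PS = ℕ → ℚ

egf : (ℕ → ℕ) → PS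
egf a n = (+ a n) ℚ./ (n !)
  where instance _ = n !≢0

sumℚ : List ℚ → ℚ
sumℚ = foldr ℚ._+_ 0ℚ

_⊕_ : PS → PS → PS
(f ⊕ g) n = f n ℚ.+ g n

_⊛_ : PS → PS → PS
(f ⊛ g) n = sumℚ (map (λ j → f j ℚ.* g (n ∸ j)) (upTo (suc n)))

onePS : PS
onePS zero    = 1ℚ
onePS (suc n) = 0ℚ

_^ps_ : PS → ℕ → PS
f ^ps zero  = onePS
f ^ps suc m = f ⊛ (f ^ps m)

divFact : ℕ → PS → PS
divFact d f n = f n ℚ.* ((+ 1) ℚ./ (d !))
  where instance _ = d !≢0

-- Coefficientwise the identity reads m(n) = Σ_{S ⊆ [n]} m(|S|)·u_{k-1}(|∁S|) + r(n), where u_j counts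
-- unordered forests of j trees and (k-1)!·u_{k-1} = t^{⋆(k-1)}, ⋆ being binomial convolution (the
-- coefficient sequence of a product of egfs). A vertex of rank ≥ i is either the root or lies in one of
-- the k subtrees of the root; in the second case, removing that subtree (with leaf set S) leaves an
-- unordered forest of k-1 trees on ∁S, and the subtree is put back at the position determined by its
-- minimal label. The same insertion bijection gives j·u_j = t ⋆ u_{j-1}, hence j!·u_j = t^{⋆j}. Trees
-- on a label set S are identified with trees on Fin |S| by the order-preserving relabelling, which
-- preserves ranks and the canonical ordering of children.

module Submission where

open import Defs
open import Data.Nat using (ℕ; _≤_; _∸_)
open import Data.Fin using (Fin)
open import Function.Bundles using (_↔_)
open import Relation.Binary.PropositionalEquality using (_≡_)

module SplitSum where

  open import Data.Nat
  open import Data.Nat.Properties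
  open import Data.Nat.Combinatorics using (_C_; nCk≡n!/k![n-k]!; k![n∸k]!∣n!; nCk+nC[k+1]≡[n+1]C[k+1])
  open import Data.Nat.DivMod using (m/n*n≡m)
  open import Data.Bool using (if_then_else_)
  open import Relation.Binary.PropositionalEquality
  open import Algebra.Properties.CommutativeSemigroup +-commutativeSemigroup using (interchange)

  nCk*k!*[n∸k]!≡n! : ∀ {n k} → k ≤ n → (n C k) * (k ! * (n ∸ k) !) ≡ n !
  nCk*k!*[n∸k]!≡n! {n} {k} k≤n = trans (cong (_* (k ! * (n ∸ k) !)) (nCk≡n!/k![n-k]! k≤n)) (m/n*n≡m (k![n∸k]!∣n! k≤n))
    where instance _ = k !* (n ∸ k) !≢0

  -- Σ over subsets S ⊆ {0,…,n-1} of F |S| |∁S|, recursing on whether 0 ∈ S.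
  splitSum : ℕ → (ℕ → ℕ → ℕ) → ℕ
  splitSum zero    F = F 0 0
  splitSum (suc n) F = splitSum n (λ a b → F (suc a) b) + splitSum n (λ a b → F a (suc b))

  splitSum-cong : ∀ n {F G} → (∀ a b → a + b ≡ n → F a b ≡ G a b) → splitSum n F ≡ splitSum n G
  splitSum-cong zero    F≗G = F≗G 0 0 refl
  splitSum-cong (suc n) F≗G = cong₂ _+_
    (splitSum-cong n (λ a b e → F≗G (suc a) b (cong suc e)))
    (splitSum-cong n (λ a b e → F≗G a (suc b) (trans (+-suc a b) (cong suc e))))

  splitSum-zero : ∀ n → splitSum n (λ _ _ → 0) ≡ 0
  splitSum-zero zero    = refl
  splitSum-zero (suc n) = cong₂ _+_ (splitSum-zero n) (splitSum-zero n)

  splitSum-+ : ∀ n F G → splitSum n (λ a b → F a b + G a b) ≡ splitSum n F + splitSum n G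
  splitSum-+ zero    F G = refl
  splitSum-+ (suc n) F G = trans
    (cong₂ _+_ (splitSum-+ n (λ a b → F (suc a) b) _) (splitSum-+ n (λ a b → F a (suc b)) _))
    (interchange (splitSum n (λ a b → F (suc a) b)) (splitSum n (λ a b → G (suc a) b))
                 (splitSum n (λ a b → F a (suc b))) (splitSum n (λ a b → G a (suc b))))

  splitSum-*ʳ : ∀ n c F → splitSum n (λ a b → F a b * c) ≡ splitSum n F * c
  splitSum-*ʳ zero    c F = refl
  splitSum-*ʳ (suc n) c F = trans
    (cong₂ _+_ (splitSum-*ʳ n c (λ a b → F (suc a) b)) (splitSum-*ʳ n c (λ a b → F a (suc b))))
    (sym (*-distribʳ-+ c (splitSum n (λ a b → F (suc a) b)) (splitSum n (λ a b → F a (suc b)))))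

  δ : ℕ → ℕ → ℕ
  δ a j = if a ≡ᵇ j then 1 else 0

  splitSum-δ : ∀ n j → splitSum n (λ a _ → δ a j) ≡ n C j
  splitSum-δ zero    zero    = refl
  splitSum-δ zero    (suc j) = refl
  splitSum-δ (suc n) zero    = cong₂ _+_ (splitSum-zero n) (splitSum-δ n 0)
  splitSum-δ (suc n) (suc j) = trans (cong₂ _+_ (splitSum-δ n j) (splitSum-δ n (suc j))) (nCk+nC[k+1]≡[n+1]C[k+1] n j)

  sumBelow : ℕ → (ℕ → ℕ) → ℕ
  sumBelow zero    h = 0
  sumBelow (suc m) h = h 0 + sumBelow m (λ j → h (suc j))

  sumBelow-cong : ∀ m {f g} → (∀ j → j < m → f j ≡ g j) → sumBelow m f ≡ sumBelow m g
  sumBelow-cong zero    f≗g = refl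
  sumBelow-cong (suc m) f≗g = cong₂ _+_ (f≗g 0 z<s) (sumBelow-cong m (λ j j<m → f≗g (suc j) (s<s j<m)))

  sumBelow-δ : ∀ m a h → a < m → sumBelow m (λ j → δ a j * h j) ≡ h a
  sumBelow-δ (suc m) zero    h _ = trans (cong₂ _+_ (+-identityʳ (h 0)) (sumBelow-zero m)) (+-identityʳ _)
    where sumBelow-zero : ∀ m → sumBelow m (λ j → δ 0 (suc j) * h (suc j)) ≡ 0
          sumBelow-zero zero    = refl
          sumBelow-zero (suc m) = sumBelow-zero m
  sumBelow-δ (suc m) (suc a) h (s<s a<m) = sumBelow-δ m a (λ j → h (suc j)) a<m

  splitSum-sumBelow : ∀ n m G → splitSum n (λ a b → sumBelow m (λ j → G j a b)) ≡ sumBelow m (λ j → splitSum n (G j))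
  splitSum-sumBelow n zero    G = splitSum-zero n
  splitSum-sumBelow n (suc m) G = trans (splitSum-+ n _ _) (cong (splitSum n (G 0) +_) (splitSum-sumBelow n m (λ j → G (suc j))))

  -- F a b = Σⱼ δ a j · F j (n ∸ j) whenever a + b = n, and splitSum is linear.
  splitSum≡binomialSum : ∀ n F → splitSum n F ≡ sumBelow (suc n) (λ j → (n C j) * F j (n ∸ j))
  splitSum≡binomialSum n F = begin
    splitSum n F
      ≡⟨ splitSum-cong n F≡Σδ ⟩
    splitSum n (λ a b → sumBelow (suc n) (λ j → δ a j * F j (n ∸ j)))
      ≡⟨ splitSum-sumBelow n (suc n) (λ j a b → δ a j * F j (n ∸ j)) ⟩
    sumBelow (suc n) (λ j → splitSum n (λ a b → δ a j * F j (n ∸ j)))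
      ≡⟨ sumBelow-cong (suc n) (λ j _ → trans (splitSum-*ʳ n _ (λ a _ → δ a j)) (cong (_* F j (n ∸ j)) (splitSum-δ n j))) ⟩
    sumBelow (suc n) (λ j → (n C j) * F j (n ∸ j)) ∎
    where
    open ≡-Reasoning
    F≡Σδ : ∀ a b → a + b ≡ n → F a b ≡ sumBelow (suc n) (λ j → δ a j * F j (n ∸ j))
    F≡Σδ a b refl = trans (cong (F a) (sym (m+n∸m≡n a b)))
                          (sym (sumBelow-δ (suc n) a (λ j → F j (n ∸ j)) (s≤s (m≤m+n a b))))

module Fractions where

  open import Data.Nat as ℕ using (ℕ; suc; NonZero)
  open import Data.Nat.Properties using (m*n≢0)
  open import Data.Integer as ℤ using (+_)
  open import Data.Integer.Properties using (pos-*)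
  open import Data.Rational using (ℚ; 0ℚ; _/_; _+_; _*_; toℚᵘ)
  open import Data.Rational.Properties using (toℚᵘ-injective; toℚᵘ-fromℚᵘ; toℚᵘ-homo-*; toℚᵘ-homo-+; 0/n≡0)
  open import Data.Rational.Unnormalised as ℚᵘ using (mkℚᵘ; _≃_; *≡*)
  open import Data.Rational.Unnormalised.Properties using (≃-trans; ≃-sym; ≃-reflexive; *-cong; +-cong)
  open import Relation.Binary.PropositionalEquality
  open import Data.Nat.Tactic.RingSolver using (solve-∀)

  infixl 6.5 _÷_
  _÷_ : ℕ → (d : ℕ) → .{{NonZero d}} → ℚ
  x ÷ d = + x / d

  private
    toℚᵘ-÷ : ∀ x d .{{_ : NonZero d}} → toℚᵘ (x ÷ d) ≃ (+ x ℚᵘ./ d)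
    toℚᵘ-÷ x (suc d) = toℚᵘ-fromℚᵘ (mkℚᵘ (+ x) d)

    ℚᵘ-cross : ∀ x p y q .{{_ : NonZero p}} .{{_ : NonZero q}} → x ℕ.* q ≡ y ℕ.* p → (+ x ℚᵘ./ p) ≃ (+ y ℚᵘ./ q)
    ℚᵘ-cross x (suc p) y (suc q) e = *≡* (trans (sym (pos-* x (suc q))) (trans (cong +_ e) (pos-* y (suc p))))

  ÷-cross : ∀ x p y q .{{_ : NonZero p}} .{{_ : NonZero q}} → x ℕ.* q ≡ y ℕ.* p → x ÷ p ≡ y ÷ q
  ÷-cross x p y q e = toℚᵘ-injective (≃-trans (toℚᵘ-÷ x p) (≃-trans (ℚᵘ-cross x p y q e) (≃-sym (toℚᵘ-÷ y q))))

  ÷-*-÷ : ∀ x p y q .{{_ : NonZero p}} .{{_ : NonZero q}} → (x ÷ p) * (y ÷ q) ≡ ((x ℕ.* y) ÷ (p ℕ.* q)) {{m*n≢0 p q}}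
  ÷-*-÷ x p@(suc _) y q@(suc _) = toℚᵘ-injective
    (≃-trans (toℚᵘ-homo-* (x ÷ p) (y ÷ q))
    (≃-trans (*-cong (toℚᵘ-÷ x p) (toℚᵘ-÷ y q))
    (≃-trans (≃-reflexive (cong (λ z → mkℚᵘ z (ℕ.pred (p ℕ.* q))) (sym (pos-* x y))))
    (≃-sym (toℚᵘ-÷ (x ℕ.* y) (p ℕ.* q))))))

  ÷-+-÷ : ∀ x y p .{{_ : NonZero p}} → (x ÷ p) + (y ÷ p) ≡ (x ℕ.+ y) ÷ p
  ÷-+-÷ x y p@(suc _) = toℚᵘ-injective
    (≃-trans (toℚᵘ-homo-+ (x ÷ p) (y ÷ p))
    (≃-trans (+-cong (toℚᵘ-÷ x p) (toℚᵘ-÷ y p))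
    (≃-trans (≃-reflexive (cong (λ z → mkℚᵘ z (ℕ.pred (p ℕ.* p))) (cong₂ ℤ._+_ (sym (pos-* x p)) (sym (pos-* y p)))))
    (≃-trans (ℚᵘ-cross (x ℕ.* p ℕ.+ y ℕ.* p) (p ℕ.* p) (x ℕ.+ y) p (shuffle x y p))
    (≃-sym (toℚᵘ-÷ (x ℕ.+ y) p))))))
    where
    shuffle : ∀ x y p → (x ℕ.* p ℕ.+ y ℕ.* p) ℕ.* p ≡ (x ℕ.+ y) ℕ.* (p ℕ.* p)
    shuffle = solve-∀

  0÷ : ∀ p .{{_ : NonZero p}} → 0 ÷ p ≡ 0ℚ
  0÷ = 0/n≡0

module ExponentialGeneratingFunctions where

  open import Data.Nat as ℕ using (ℕ; zero; suc; _∸_; _!; _≤_; _<_; z<s; s<s)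
  open import Data.Nat.Properties as ℕ using (_!≢0; _!*_!≢0; ≤-pred)
  open import Data.Nat.Combinatorics using (_C_)
  open import Data.Rational using (ℚ; _+_; _*_)
  open import Data.List using (map; upTo; applyUpTo)
  open import Data.List.Properties using (map-cong)
  open import Data.Product using (Σ; _×_; _,_)
  open import Relation.Binary.PropositionalEquality
  open import Data.Nat.Tactic.RingSolver using (solve-∀)
  open SplitSum
  open Fractions

  infixl 7 _⋆_
  _⋆_ : (ℕ → ℕ) → (ℕ → ℕ) → ℕ → ℕ
  (a ⋆ b) n = splitSum n (λ x y → a x ℕ.* b y)

  _⋆^_ : (ℕ → ℕ) → ℕ → ℕ → ℕ
  (t ⋆^ zero)  n = δ n 0
  (t ⋆^ suc p) n = (t ⋆ (t ⋆^ p)) n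

  ⋆-congʳ : ∀ a {b b'} → (∀ l → b l ≡ b' l) → ∀ n → (a ⋆ b) n ≡ (a ⋆ b') n
  ⋆-congʳ a b≗b' n = splitSum-cong n (λ x y _ → cong (a x ℕ.*_) (b≗b' y))

  *-⋆ : ∀ c a b n → c ℕ.* (a ⋆ b) n ≡ (a ⋆ (λ l → c ℕ.* b l)) n
  *-⋆ c a b n = begin
    c ℕ.* (a ⋆ b) n                                ≡⟨ ℕ.*-comm c _ ⟩
    (a ⋆ b) n ℕ.* c                                ≡⟨ splitSum-*ʳ n c _ ⟨
    splitSum n (λ x y → a x ℕ.* b y ℕ.* c)        ≡⟨ splitSum-cong n (λ x y _ → reorder (a x) (b y) c) ⟩
    (a ⋆ (λ l → c ℕ.* b l)) n                      ∎
    where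
    open ≡-Reasoning
    reorder : ∀ x y c → x ℕ.* y ℕ.* c ≡ x ℕ.* (c ℕ.* y)
    reorder = solve-∀

  sumℚ-applyUpTo : ∀ m (f : ℕ → ℕ) (h : ℕ → ℚ) (g : ℕ → ℕ) N .{{_ : ℕ.NonZero N}} →
                   (∀ j → j < m → h (f j) ≡ g j ÷ N) → sumℚ (map h (applyUpTo f m)) ≡ sumBelow m g ÷ N
  sumℚ-applyUpTo zero    f h g N _    = sym (0÷ N)
  sumℚ-applyUpTo (suc m) f h g N h≡g÷ = trans
    (cong₂ _+_ (h≡g÷ 0 z<s) (sumℚ-applyUpTo m (λ j → f (suc j)) h (λ j → g (suc j)) N (λ j j<m → h≡g÷ (suc j) (s<s j<m))))
    (÷-+-÷ (g 0) _ N)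

  egf-*-egf : ∀ a b {n j} → j ≤ n → egf a j * egf b (n ∸ j) ≡ ((n C j) ℕ.* (a j ℕ.* b (n ∸ j)) ÷ n !) {{n !≢0}}
  egf-*-egf a b {n} {j} j≤n = trans
    (÷-*-÷ (a j) (j !) (b l) (l !) {{j !≢0}} {{l !≢0}})
    (÷-cross (a j ℕ.* b l) (j ! ℕ.* l !) ((n C j) ℕ.* (a j ℕ.* b l)) (n !) {{j !* l !≢0}} {{n !≢0}} cross)
    where
    l = n ∸ j
    binomial : (n C j) ℕ.* (j ! ℕ.* l !) ≡ n !
    binomial = nCk*k!*[n∸k]!≡n! j≤n
    cross : (a j ℕ.* b l) ℕ.* n ! ≡ ((n C j) ℕ.* (a j ℕ.* b l)) ℕ.* (j ! ℕ.* l !)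
    cross = trans (cong ((a j ℕ.* b l) ℕ.*_) (sym binomial)) (reorder (a j ℕ.* b l) (n C j) (j ! ℕ.* l !))
      where reorder : ∀ x c f → x ℕ.* (c ℕ.* f) ≡ (c ℕ.* x) ℕ.* f
            reorder = solve-∀

  egf-⋆ : ∀ a b n → (egf a ⊛ egf b) n ≡ egf (a ⋆ b) n
  egf-⋆ a b n = trans
    (sumℚ-applyUpTo (suc n) (λ j → j) (λ j → egf a j * egf b (n ∸ j)) (λ j → (n C j) ℕ.* (a j ℕ.* b (n ∸ j)))
                    (n !) {{n !≢0}} (λ j j<1+n → egf-*-egf a b (≤-pred j<1+n)))
    (cong (λ z → (z ÷ n !) {{n !≢0}}) (sym (splitSum≡binomialSum n (λ x y → a x ℕ.* b y))))

  ⊛-congʳ : ∀ f {g g'} → (∀ n → g n ≡ g' n) → ∀ n → (f ⊛ g) n ≡ (f ⊛ g') n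
  ⊛-congʳ f g≗g' n = cong sumℚ (map-cong (λ j → cong (f j *_) (g≗g' (n ∸ j))) (upTo (suc n)))

  egf-^ps : ∀ t p n → (egf t ^ps p) n ≡ egf (t ⋆^ p) n
  egf-^ps t zero    zero    = refl
  egf-^ps t zero    (suc n) = sym (0÷ (suc n !) {{suc n !≢0}})
  egf-^ps t (suc p) n       = trans (⊛-congʳ (egf t) (egf-^ps t p) n) (egf-⋆ t (t ⋆^ p) n)

  divFact-egf : ∀ p s u → (∀ l → p ! ℕ.* u l ≡ s l) → ∀ n → divFact p (egf s) n ≡ egf u n
  divFact-egf p s u p!u≡s n = trans
    (÷-*-÷ (s n) (n !) 1 (p !) {{n !≢0}} {{p !≢0}})
    (÷-cross (s n ℕ.* 1) (n ! ℕ.* p !) (u n) (n !) {{n !* p !≢0}} {{n !≢0}}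
      (trans (cong (λ z → (z ℕ.* 1) ℕ.* n !) (sym (p!u≡s n))) (reorder (p !) (u n) (n !))))
    where reorder : ∀ f x g → (f ℕ.* x ℕ.* 1) ℕ.* g ≡ x ℕ.* (g ℕ.* f)
          reorder = solve-∀

  egf-recurrence : ∀ p t m r →
                   Σ (ℕ → ℕ) (λ u → (∀ l → p ! ℕ.* u l ≡ (t ⋆^ p) l) × (∀ n → m n ≡ (m ⋆ u) n ℕ.+ r n)) →
                   ∀ n → egf m n ≡ ((egf m ⊛ divFact p (egf t ^ps p)) ⊕ egf r) n
  egf-recurrence p t m r (u , p!u≡t^p , m≡m⋆u+r) n = sym (begin
    (egf m ⊛ divFact p (egf t ^ps p)) n + egf r n
      ≡⟨ cong (_+ egf r n) (⊛-congʳ (egf m) divFact-t^p n) ⟩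
    (egf m ⊛ egf u) n + egf r n
      ≡⟨ cong (_+ egf r n) (egf-⋆ m u n) ⟩
    egf (m ⋆ u) n + egf r n
      ≡⟨ ÷-+-÷ ((m ⋆ u) n) (r n) (n !) {{n !≢0}} ⟩
    (((m ⋆ u) n ℕ.+ r n) ÷ n !) {{n !≢0}}
      ≡⟨ cong (λ z → (z ÷ n !) {{n !≢0}}) (sym (m≡m⋆u+r n)) ⟩
    egf m n ∎)
    where
    open ≡-Reasoning
    divFact-t^p : ∀ l → divFact p (egf t ^ps p) l ≡ egf u l
    divFact-t^p l = trans (cong (_* _) (egf-^ps t p l)) (divFact-egf p (t ⋆^ p) u p!u≡t^p l)

module BooleanFacts where

  open import Data.Nat using (zero; suc; _<_; _≤_; _<ᵇ_)
  open import Data.Nat.Properties using (<⇒<ᵇ; <ᵇ⇒<; <⇒≱)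
  open import Data.Fin using (Fin; zero; suc)
  open import Data.Bool using (Bool; true; false; _∧_)
  open import Data.Bool.Properties using (_≟_; T-≡; ¬-not; ∧-conicalˡ; ∧-conicalʳ)
  open import Function.Bundles using (Equivalence; _↔_; mk↔ₛ′)
  open import Relation.Nullary using (¬_)
  open import Data.Bool.ListAction using (all)
  open import Data.List using (tabulate)
  open import Data.Product using (Σ; _,_)
  open import Relation.Binary.PropositionalEquality
  open import Axiom.UniquenessOfIdentityProofs using (module Decidable⇒UIP)

  true≢false : ¬ true ≡ false
  true≢false ()

  ≡true-irrelevant : ∀ {b : Bool} (p q : b ≡ true) → p ≡ q
  ≡true-irrelevant = Decidable⇒UIP.≡-irrelevant _≟_

  Σ-≡true-≡ : ∀ {A : Set} (f : A → Bool) {a a' : A} → a ≡ a' → (p : f a ≡ true) (q : f a' ≡ true) →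
              _≡_ {A = Σ A (λ a → f a ≡ true)} (a , p) (a' , q)
  Σ-≡true-≡ f refl p q = cong (_ ,_) (≡true-irrelevant p q)

  Σ-≡true-↔ : ∀ {A B : Set} (p : A → Bool) (q : B → Bool) (f : A → B) (g : ∀ b → q b ≡ true → A) →
              (∀ a → q (f a) ≡ p a) → (∀ b qb → f (g b qb) ≡ b) → (∀ a qfa → g (f a) qfa ≡ a) →
              Σ A (λ a → p a ≡ true) ↔ Σ B (λ b → q b ≡ true)
  Σ-≡true-↔ p q f g q∘f≡p f∘g≡id g∘f≡id = mk↔ₛ′ to from to∘from from∘to
    where
    to : Σ _ (λ a → p a ≡ true) → Σ _ (λ b → q b ≡ true)
    to (a , pa) = f a , trans (q∘f≡p a) pa
    from : Σ _ (λ b → q b ≡ true) → Σ _ (λ a → p a ≡ true)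
    from (b , qb) = g b qb , trans (sym (q∘f≡p (g b qb))) (trans (cong q (f∘g≡id b qb)) qb)
    to∘from : ∀ y → to (from y) ≡ y
    to∘from (b , qb) = Σ-≡true-≡ q (f∘g≡id b qb) _ _
    from∘to : ∀ x → from (to x) ≡ x
    from∘to (a , pa) = Σ-≡true-≡ p (g∘f≡id a _) _ _

  ≡true-ext : ∀ {a b : Bool} → (a ≡ true → b ≡ true) → (b ≡ true → a ≡ true) → a ≡ b
  ≡true-ext {true}  {true}  a⇒b b⇒a = refl
  ≡true-ext {true}  {false} a⇒b b⇒a = sym (a⇒b refl)
  ≡true-ext {false} {true}  a⇒b b⇒a = b⇒a refl
  ≡true-ext {false} {false} a⇒b b⇒a = refl

  ∧-trueˡ : ∀ {a b} → a ∧ b ≡ true → a ≡ true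
  ∧-trueˡ {a} {b} = ∧-conicalˡ a b

  ∧-trueʳ : ∀ {a b} → a ∧ b ≡ true → b ≡ true
  ∧-trueʳ {a} {b} = ∧-conicalʳ a b

  <⇒<ᵇ≡true : ∀ {m n} → m < n → (m <ᵇ n) ≡ true
  <⇒<ᵇ≡true m<n = Equivalence.to T-≡ (<⇒<ᵇ m<n)

  <ᵇ≡true⇒< : ∀ {m n} → (m <ᵇ n) ≡ true → m < n
  <ᵇ≡true⇒< {m} {n} m<ᵇn = <ᵇ⇒< m n (Equivalence.from T-≡ m<ᵇn)

  ≥⇒<ᵇ≡false : ∀ {m n} → n ≤ m → (m <ᵇ n) ≡ false
  ≥⇒<ᵇ≡false {m} {n} n≤m = ¬-not (λ m<ᵇn → <⇒≱ (<ᵇ≡true⇒< m<ᵇn) n≤m)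

  all-tabulate⁻ : ∀ {A : Set} {n} (f : A → Bool) (g : Fin n → A) → all f (tabulate g) ≡ true → ∀ x → f (g x) ≡ true
  all-tabulate⁻ f g all≡true zero    = ∧-trueˡ all≡true
  all-tabulate⁻ f g all≡true (suc x) = all-tabulate⁻ f (λ y → g (suc y)) (∧-trueʳ {f (g zero)} all≡true) x

  all-tabulate⁺ : ∀ {A : Set} {n} (f : A → Bool) (g : Fin n → A) → (∀ x → f (g x) ≡ true) → all f (tabulate g) ≡ true
  all-tabulate⁺ {n = zero}  f g fg≡true = refl
  all-tabulate⁺ {n = suc n} f g fg≡true =
    cong₂ _∧_ (fg≡true zero) (all-tabulate⁺ f (λ y → g (suc y)) (λ y → fg≡true (suc y)))

module Occurrences where

  open import Data.Nat using (ℕ; _+_; _≡ᵇ_; _≤_; z≤n; s≤s)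
  open import Data.Nat.Properties using (≡ᵇ⇒≡; ≡⇒≡ᵇ; m≤n+m; ≤-trans)
  open import Data.Fin as Fin using (Fin; _≟_)
  open import Data.Fin.Subset using (Subset; ⊤; ∁)
  open import Data.Vec using (lookup)
  open import Data.Vec.Properties using (lookup-replicate; lookup-map)
  open import Data.List as List using (List; []; _∷_; _++_; filter; length; allFin)
  open import Data.List.Properties using (filter-++; length-++)
  open import Data.List.Relation.Unary.All as All using (All)
  open import Data.List.Membership.Propositional using (_∈_)
  open import Data.List.Relation.Unary.Any using (here; there)
  open import Data.Bool using (Bool; true; false; if_then_else_; not)
  open import Data.Bool.Properties using (T-≡)
  open import Data.Bool.ListAction using (all)
  open import Function.Bundles using (Equivalence)
  open import Relation.Nullary using (does; yes; no; ¬_; contradiction)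
  open import Relation.Binary.PropositionalEquality
  open BooleanFacts

  private variable n m : ℕ

  occurrences : Fin n → List (Fin n) → ℕ
  occurrences x l = length (filter (x ≟_) l)

  δᶠ : Fin n → Fin n → ℕ
  δᶠ x y = if does (x ≟ y) then 1 else 0

  δᶠ-refl : (x : Fin n) → δᶠ x x ≡ 1
  δᶠ-refl x with x ≟ x
  ... | yes _   = refl
  ... | no x≢x = contradiction refl x≢x

  δᶠ-≢ : {x y : Fin n} → ¬ x ≡ y → δᶠ x y ≡ 0
  δᶠ-≢ {x = x} {y = y} x≢y with x ≟ y
  ... | yes x≡y = contradiction x≡y x≢y
  ... | no _    = refl

  occurrences-∷ : (x y : Fin n) (l : List (Fin n)) → occurrences x (y ∷ l) ≡ δᶠ x y + occurrences x l
  occurrences-∷ x y l with x ≟ y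
  ... | yes _ = refl
  ... | no _  = refl

  occurrences-++ : (x : Fin n) (l₁ l₂ : List (Fin n)) → occurrences x (l₁ ++ l₂) ≡ occurrences x l₁ + occurrences x l₂
  occurrences-++ x l₁ l₂ = trans (cong length (filter-++ (x ≟_) l₁ l₂)) (length-++ (filter (x ≟_) l₁))

  ∈⇒1≤occurrences : {x : Fin n} {l : List (Fin n)} → x ∈ l → 1 ≤ occurrences x l
  ∈⇒1≤occurrences {x = x} {_ ∷ l} (here refl) = subst (1 ≤_) (sym (occurrences-∷ x x l))
    (subst (λ d → 1 ≤ d + occurrences x l) (sym (δᶠ-refl x)) (s≤s z≤n))
  ∈⇒1≤occurrences {x = x} {y ∷ l} (there x∈l) = subst (1 ≤_) (sym (occurrences-∷ x y l))
    (≤-trans (∈⇒1≤occurrences x∈l) (m≤n+m _ (δᶠ x y)))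

  occurrences-map-injective : (f : Fin m → Fin n) → (∀ {y z} → f y ≡ f z → y ≡ z) →
                              ∀ y (l : List (Fin m)) → occurrences (f y) (List.map f l) ≡ occurrences y l
  occurrences-map-injective f f-inj y []      = refl
  occurrences-map-injective f f-inj y (z ∷ l) = begin
    occurrences (f y) (f z ∷ List.map f l)     ≡⟨ occurrences-∷ (f y) (f z) _ ⟩
    δᶠ (f y) (f z) + occurrences (f y) (List.map f l)
      ≡⟨ cong₂ _+_ (δᶠ-injective y z) (occurrences-map-injective f f-inj y l) ⟩
    δᶠ y z + occurrences y l                   ≡⟨ occurrences-∷ y z l ⟨
    occurrences y (z ∷ l)                      ∎
    where
    open ≡-Reasoning
    δᶠ-injective : ∀ y z → δᶠ (f y) (f z) ≡ δᶠ y z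
    δᶠ-injective y z with y Fin.≟ z
    ... | yes refl = δᶠ-refl (f y)
    ... | no y≢z   = δᶠ-≢ (λ fy≡fz → y≢z (f-inj fy≡fz))

  occurrences-map-∉ : (f : Fin m → Fin n) (x : Fin n) → (∀ y → ¬ f y ≡ x) →
                      ∀ (l : List (Fin m)) → occurrences x (List.map f l) ≡ 0
  occurrences-map-∉ f x x∉f []      = refl
  occurrences-map-∉ f x x∉f (z ∷ l) =
    trans (occurrences-∷ x (f z) _) (cong₂ _+_ (δᶠ-≢ (λ x≡fz → x∉f z (sym x≡fz))) (occurrences-map-∉ f x x∉f l))

  χ : Subset n → Fin n → ℕ
  χ S x = if lookup S x then 1 else 0

  χ-⊤ : (x : Fin n) → χ ⊤ x ≡ 1
  χ-⊤ x = cong (λ b → if b then 1 else 0) (lookup-replicate x true)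

  χ+χ-∁ : (S : Subset n) (x : Fin n) → χ S x + χ (∁ S) x ≡ 1
  χ+χ-∁ S x rewrite lookup-map x not S with lookup S x
  ... | true  = refl
  ... | false = refl

  1≤χ⇒∈ : (S : Subset n) (x : Fin n) → 1 ≤ χ S x → lookup S x ≡ true
  1≤χ⇒∈ S x 1≤χ with lookup S x
  ... | true = refl

  record Enumerates (S : Subset n) (l : List (Fin n)) : Set where
    constructor enumerating
    field occurrences≡χ : ∀ x → occurrences x l ≡ χ S x
  open Enumerates public

  -- Validity of trees is kept boolean so that Σ-types over it have irrelevant second components.
  enumerates : ∀ {n} → Subset n → List (Fin n) → Bool
  enumerates {n} S l = all (λ x → occurrences x l ≡ᵇ χ S x) (allFin n)

  enumerates⇒ : {S : Subset n} {l : List (Fin n)} → enumerates S l ≡ true → Enumerates S l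
  enumerates⇒ {S = S} {l} e =
    enumerating λ x → ≡ᵇ⇒≡ _ _ (Equivalence.from T-≡ (all-tabulate⁻ (λ x → occurrences x l ≡ᵇ χ S x) (λ x → x) e x))

  ⇒enumerates : {S : Subset n} {l : List (Fin n)} → Enumerates S l → enumerates S l ≡ true
  ⇒enumerates e = all-tabulate⁺ _ (λ x → x) (λ x → Equivalence.to T-≡ (≡⇒≡ᵇ _ _ (occurrences≡χ e x)))

  Enumerates⇒⊆ : ∀ {S : Subset n} {l} → Enumerates S l → All (λ x → lookup S x ≡ true) l
  Enumerates⇒⊆ {S = S} e = All.tabulate (λ {x} x∈l → 1≤χ⇒∈ S x (subst (1 ≤_) (occurrences≡χ e x) (∈⇒1≤occurrences x∈l)))

module SubsetEmbedding where

  open import Data.Nat using (ℕ; zero; suc; _≤_; _<_; z≤n; s≤s)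
  open import Data.Fin using (Fin; zero; suc; toℕ)
  open import Data.Fin.Subset using (Subset; ∣_∣)
  open import Data.Vec using ([]; _∷_; lookup)
  open import Data.Bool using (true; false)
  open import Relation.Binary.PropositionalEquality
  open BooleanFacts

  embed : ∀ {n} (S : Subset n) → Fin ∣ S ∣ → Fin n
  embed (true ∷ S)  zero    = zero
  embed (true ∷ S)  (suc y) = suc (embed S y)
  embed (false ∷ S) y       = suc (embed S y)

  index : ∀ {n} (S : Subset n) (x : Fin n) → lookup S x ≡ true → Fin ∣ S ∣
  index (true ∷ S)  zero    _   = zero
  index (true ∷ S)  (suc x) x∈S = suc (index S x x∈S)
  index (false ∷ S) (suc x) x∈S = index S x x∈S

  embed-index : ∀ {n} (S : Subset n) x x∈S → embed S (index S x x∈S) ≡ x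
  embed-index (true ∷ S)  zero    _   = refl
  embed-index (true ∷ S)  (suc x) x∈S = cong suc (embed-index S x x∈S)
  embed-index (false ∷ S) (suc x) x∈S = cong suc (embed-index S x x∈S)

  index-embed : ∀ {n} (S : Subset n) y y∈S → index S (embed S y) y∈S ≡ y
  index-embed (true ∷ S)  zero    _   = refl
  index-embed (true ∷ S)  (suc y) y∈S = cong suc (index-embed S y y∈S)
  index-embed (false ∷ S) y       y∈S = index-embed S y y∈S

  embed-∈ : ∀ {n} (S : Subset n) y → lookup S (embed S y) ≡ true
  embed-∈ (true ∷ S)  zero    = refl
  embed-∈ (true ∷ S)  (suc y) = embed-∈ S y
  embed-∈ (false ∷ S) y       = embed-∈ S y

  embed-injective : ∀ {n} (S : Subset n) {y y'} → embed S y ≡ embed S y' → y ≡ y'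
  embed-injective S {y} {y'} e = begin
    y                             ≡⟨ index-embed S y (embed-∈ S y) ⟨
    index S (embed S y) _         ≡⟨ index-cong e ⟩
    index S (embed S y') _        ≡⟨ index-embed S y' (embed-∈ S y') ⟩
    y'                            ∎
    where
    open ≡-Reasoning
    index-cong : ∀ {x x'} (e : x ≡ x') {p q} → index S x p ≡ index S x' q
    index-cong refl {p} {q} = cong (index S _) (≡true-irrelevant p q)

  -- toℕ ∘ embed S extended monotonically by ∣ S ∣ ↦ n, matching minLabel's use of n as +∞.
  embedℕ : ∀ {n} → Subset n → ℕ → ℕ
  embedℕ []          a       = 0
  embedℕ (true ∷ S)  zero    = 0
  embedℕ (true ∷ S)  (suc a) = suc (embedℕ S a)
  embedℕ (false ∷ S) a       = suc (embedℕ S a)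

  toℕ-embed : ∀ {n} (S : Subset n) y → toℕ (embed S y) ≡ embedℕ S (toℕ y)
  toℕ-embed (true ∷ S)  zero    = refl
  toℕ-embed (true ∷ S)  (suc y) = cong suc (toℕ-embed S y)
  toℕ-embed (false ∷ S) y       = cong suc (toℕ-embed S y)

  embedℕ-∣S∣ : ∀ {n} (S : Subset n) → embedℕ S ∣ S ∣ ≡ n
  embedℕ-∣S∣ []          = refl
  embedℕ-∣S∣ (true ∷ S)  = cong suc (embedℕ-∣S∣ S)
  embedℕ-∣S∣ (false ∷ S) = cong suc (embedℕ-∣S∣ S)

  embedℕ-mono-≤ : ∀ {n} (S : Subset n) {a b} → a ≤ b → embedℕ S a ≤ embedℕ S b
  embedℕ-mono-≤ []          a≤b                       = z≤n
  embedℕ-mono-≤ (true ∷ S)  {zero}          a≤b       = z≤n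
  embedℕ-mono-≤ (true ∷ S)  {suc a} {suc b} (s≤s a≤b) = s≤s (embedℕ-mono-≤ S a≤b)
  embedℕ-mono-≤ (false ∷ S) a≤b                       = s≤s (embedℕ-mono-≤ S a≤b)

  embedℕ-mono-< : ∀ {n} (S : Subset n) {a b} → a < b → b ≤ ∣ S ∣ → embedℕ S a < embedℕ S b
  embedℕ-mono-< (true ∷ S)  {zero}  {suc b} a<b       b≤∣S∣       = s≤s z≤n
  embedℕ-mono-< (true ∷ S)  {suc a} {suc b} (s≤s a<b) (s≤s b≤∣S∣) = s≤s (embedℕ-mono-< S a<b b≤∣S∣)
  embedℕ-mono-< (false ∷ S) a<b                       b≤∣S∣       = s≤s (embedℕ-mono-< S a<b b≤∣S∣)

module Relabelling (k : ℕ) where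

  open import Data.Nat using (ℕ; suc; _≤_; _⊓_)
  open import Data.Nat.Properties using (≤-irrelevant)
  open import Data.Fin using (Fin; zero; suc)
  open import Data.Vec using (Vec; []; _∷_; lookup)
  open import Data.List as List using (_++_)
  open import Data.List.Properties using (map-++)
  open import Data.Product using (Σ; _,_)
  open import Function.Bundles using (_↔_; mk↔ₛ′)
  open import Relation.Binary.PropositionalEquality

  mutual
    relabel : ∀ {n n'} → (Fin n → Fin n') → PTree k n → PTree k n'
    relabel f (leaf x)  = leaf (f x)
    relabel f (node cs) = node (relabelⱽ f cs)

    relabelⱽ : ∀ {n n' j} → (Fin n → Fin n') → Vec (PTree k n) j → Vec (PTree k n') j
    relabelⱽ f []       = []
    relabelⱽ f (c ∷ cs) = relabel f c ∷ relabelⱽ f cs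

  mutual
    leaves-relabel : ∀ {n n'} (f : Fin n → Fin n') T → leaves (relabel f T) ≡ List.map f (leaves T)
    leaves-relabel f (leaf x)  = refl
    leaves-relabel f (node cs) = leavesV-relabelⱽ f cs

    leavesV-relabelⱽ : ∀ {n n' j} (f : Fin n → Fin n') (cs : Vec (PTree k n) j) →
                       leavesV (relabelⱽ f cs) ≡ List.map f (leavesV cs)
    leavesV-relabelⱽ f []       = refl
    leavesV-relabelⱽ f (c ∷ cs) =
      trans (cong₂ _++_ (leaves-relabel f c) (leavesV-relabelⱽ f cs)) (sym (map-++ f (leaves c) (leavesV cs)))

  mutual
    rank-relabel : ∀ {n n'} (f : Fin n → Fin n') T → rank (relabel f T) ≡ rank T
    rank-relabel f (leaf x)         = refl
    rank-relabel f (node [])        = refl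
    rank-relabel f (node (c ∷ cs))  =
      cong suc (trans (minRank-relabelⱽ f (rank (relabel f c)) cs) (cong (λ a → minRank a cs) (rank-relabel f c)))

    minRank-relabelⱽ : ∀ {n n' j} (f : Fin n → Fin n') acc (ds : Vec (PTree k n) j) →
                       minRank acc (relabelⱽ f ds) ≡ minRank acc ds
    minRank-relabelⱽ f acc []       = refl
    minRank-relabelⱽ f acc (d ∷ ds) =
      trans (minRank-relabelⱽ f (acc ⊓ rank (relabel f d)) ds) (cong (λ r → minRank (acc ⊓ r) ds) (rank-relabel f d))

  HighVertex : ℕ → ∀ {n} → PTree k n → Set
  HighVertex i T = Σ (Pos T) (λ v → i ≤ rank (subtree T v))

  module _ {n n'} (f : Fin n → Fin n') where

    mutual
      relabelPos : ∀ T → Pos T → Pos (relabel f T)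
      relabelPos T         here        = here
      relabelPos (node cs) (there j v) = there j (relabelPosⱽ cs j v)

      relabelPosⱽ : ∀ {m} (cs : Vec (PTree k n) m) j → Pos (lookup cs j) → Pos (lookup (relabelⱽ f cs) j)
      relabelPosⱽ (c ∷ cs) zero    v = relabelPos c v
      relabelPosⱽ (c ∷ cs) (suc j) v = relabelPosⱽ cs j v

    mutual
      unrelabelPos : ∀ T → Pos (relabel f T) → Pos T
      unrelabelPos (leaf x)  here        = here
      unrelabelPos (node cs) here        = here
      unrelabelPos (node cs) (there j v) = there j (unrelabelPosⱽ cs j v)

      unrelabelPosⱽ : ∀ {m} (cs : Vec (PTree k n) m) j → Pos (lookup (relabelⱽ f cs) j) → Pos (lookup cs j)
      unrelabelPosⱽ (c ∷ cs) zero    v = unrelabelPos c v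
      unrelabelPosⱽ (c ∷ cs) (suc j) v = unrelabelPosⱽ cs j v

    mutual
      unrelabel-relabelPos : ∀ T v → unrelabelPos T (relabelPos T v) ≡ v
      unrelabel-relabelPos (leaf x)  here        = refl
      unrelabel-relabelPos (node cs) here        = refl
      unrelabel-relabelPos (node cs) (there j v) = cong (there j) (unrelabel-relabelPosⱽ cs j v)

      unrelabel-relabelPosⱽ : ∀ {m} (cs : Vec (PTree k n) m) j v → unrelabelPosⱽ cs j (relabelPosⱽ cs j v) ≡ v
      unrelabel-relabelPosⱽ (c ∷ cs) zero    v = unrelabel-relabelPos c v
      unrelabel-relabelPosⱽ (c ∷ cs) (suc j) v = unrelabel-relabelPosⱽ cs j v

    mutual
      relabel-unrelabelPos : ∀ T v → relabelPos T (unrelabelPos T v) ≡ v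
      relabel-unrelabelPos (leaf x)  here        = refl
      relabel-unrelabelPos (node cs) here        = refl
      relabel-unrelabelPos (node cs) (there j v) = cong (there j) (relabel-unrelabelPosⱽ cs j v)

      relabel-unrelabelPosⱽ : ∀ {m} (cs : Vec (PTree k n) m) j v → relabelPosⱽ cs j (unrelabelPosⱽ cs j v) ≡ v
      relabel-unrelabelPosⱽ (c ∷ cs) zero    v = relabel-unrelabelPos c v
      relabel-unrelabelPosⱽ (c ∷ cs) (suc j) v = relabel-unrelabelPosⱽ cs j v

    mutual
      subtree-relabelPos : ∀ T v → subtree (relabel f T) (relabelPos T v) ≡ relabel f (subtree T v)
      subtree-relabelPos T         here        = refl
      subtree-relabelPos (node cs) (there j v) = subtree-relabelPosⱽ cs j v

      subtree-relabelPosⱽ : ∀ {m} (cs : Vec (PTree k n) m) j v →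
                            subtree (lookup (relabelⱽ f cs) j) (relabelPosⱽ cs j v) ≡ relabel f (subtree (lookup cs j) v)
      subtree-relabelPosⱽ (c ∷ cs) zero    v = subtree-relabelPos c v
      subtree-relabelPosⱽ (c ∷ cs) (suc j) v = subtree-relabelPosⱽ cs j v

    rank-subtree-relabelPos : ∀ T v → rank (subtree (relabel f T) (relabelPos T v)) ≡ rank (subtree T v)
    rank-subtree-relabelPos T v = trans (cong rank (subtree-relabelPos T v)) (rank-relabel f (subtree T v))

    HighVertex-relabel : ∀ i T → HighVertex i T ↔ HighVertex i (relabel f T)
    HighVertex-relabel i T = mk↔ₛ′ to from to∘from from∘to
      where
      Σ-≤-≡ : ∀ {A : Set} (h : A → ℕ) {a b : A} → a ≡ b → (p : i ≤ h a) (q : i ≤ h b) →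
              _≡_ {A = Σ A (λ a → i ≤ h a)} (a , p) (b , q)
      Σ-≤-≡ h refl p q = cong (_ ,_) (≤-irrelevant p q)
      to : HighVertex i T → HighVertex i (relabel f T)
      to (v , i≤r) = relabelPos T v , subst (i ≤_) (sym (rank-subtree-relabelPos T v)) i≤r
      from : HighVertex i (relabel f T) → HighVertex i T
      from (v , i≤r) = unrelabelPos T v ,
        subst (i ≤_) (trans (cong (λ w → rank (subtree (relabel f T) w)) (sym (relabel-unrelabelPos T v)))
                            (rank-subtree-relabelPos T (unrelabelPos T v))) i≤r
      to∘from : ∀ y → to (from y) ≡ y
      to∘from (v , _) = Σ-≤-≡ (λ w → rank (subtree (relabel f T) w)) (relabel-unrelabelPos T v) _ _
      from∘to : ∀ x → from (to x) ≡ x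
      from∘to (v , _) = Σ-≤-≡ (λ w → rank (subtree T w)) (unrelabel-relabelPos T v) _ _

module TreesOnSubsets (k : ℕ) where

  open import Data.Nat using (ℕ; zero; suc; _≤_; _⊓_; _<ᵇ_)
  open import Data.Nat.Properties using (mono-≤-distrib-⊓; m⊓n≤n; ≤-refl; ≤-trans; <-≤-connex)
  open import Data.Fin using (Fin; zero; suc; toℕ)
  open import Data.Fin.Subset using (Subset; ∣_∣; ⊤)
  open import Data.Vec as Vec using (Vec; []; _∷_; lookup)
  open import Data.List as List using (List; []; _∷_; foldr)
  open import Data.List.Relation.Unary.All using (All; []; _∷_)
  open import Data.List.Relation.Unary.All.Properties using (++⁻ˡ; ++⁻ʳ)
  open import Data.Bool using (Bool; true; false; _∧_; if_then_else_)
  open import Data.Product using (Σ; _,_; proj₁)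
  open import Data.Sum using (inj₁; inj₂)
  open import Function.Bundles using (_↔_)
  open import Relation.Binary.PropositionalEquality
  open BooleanFacts
  open Occurrences
  open SubsetEmbedding
  open Relabelling k

  minLabel≤n : ∀ {n} (T : PTree k n) → minLabel T ≤ n
  minLabel≤n {n} T = foldr-⊓≤ (List.map toℕ (leaves T))
    where
    foldr-⊓≤ : ∀ l → foldr _⊓_ n l ≤ n
    foldr-⊓≤ []      = ≤-refl
    foldr-⊓≤ (a ∷ l) = ≤-trans (m⊓n≤n a _) (foldr-⊓≤ l)

  minLabel-embed : ∀ {n} (S : Subset n) (T : PTree k ∣ S ∣) → minLabel (relabel (embed S) T) ≡ embedℕ S (minLabel T)
  minLabel-embed {n} S T =
    trans (cong (λ l → foldr _⊓_ n (List.map toℕ l)) (leaves-relabel (embed S) T)) (foldr-embed (leaves T))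
    where
    foldr-embed : ∀ l → foldr _⊓_ n (List.map toℕ (List.map (embed S) l)) ≡ embedℕ S (foldr _⊓_ ∣ S ∣ (List.map toℕ l))
    foldr-embed []      = sym (embedℕ-∣S∣ S)
    foldr-embed (y ∷ l) = trans (cong₂ _⊓_ (toℕ-embed S y) (foldr-embed l))
                                (sym (mono-≤-distrib-⊓ (embedℕ-mono-≤ S) (toℕ y) _))

  -- Defs.increasing does not depend on its implicit tree parameters.
  sorted : List ℕ → Bool
  sorted = increasing {0} {0}

  childMinLabels : ∀ {n j} → Vec (PTree k n) j → List ℕ
  childMinLabels cs = List.map minLabel (Vec.toList cs)

  <ᵇ-embedℕ : ∀ {n} (S : Subset n) {a b} → a ≤ ∣ S ∣ → b ≤ ∣ S ∣ → (embedℕ S a <ᵇ embedℕ S b) ≡ (a <ᵇ b)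
  <ᵇ-embedℕ S {a} {b} a≤∣S∣ b≤∣S∣ with <-≤-connex a b
  ... | inj₁ a<b = trans (<⇒<ᵇ≡true (embedℕ-mono-< S a<b b≤∣S∣)) (sym (<⇒<ᵇ≡true a<b))
  ... | inj₂ b≤a = trans (≥⇒<ᵇ≡false (embedℕ-mono-≤ S b≤a)) (sym (≥⇒<ᵇ≡false b≤a))

  sorted-map-embedℕ : ∀ {n} (S : Subset n) xs → All (_≤ ∣ S ∣) xs → sorted (List.map (embedℕ S) xs) ≡ sorted xs
  sorted-map-embedℕ S []           _                  = refl
  sorted-map-embedℕ S (a ∷ [])     _                  = refl
  sorted-map-embedℕ S (a ∷ b ∷ xs) (a≤ ∷ b≤ ∷ xs≤) =
    cong₂ _∧_ (<ᵇ-embedℕ S a≤ b≤) (sorted-map-embedℕ S (b ∷ xs) (b≤ ∷ xs≤))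

  childMinLabels-embed : ∀ {n j} (S : Subset n) (cs : Vec (PTree k ∣ S ∣) j) →
                         childMinLabels (relabelⱽ (embed S) cs) ≡ List.map (embedℕ S) (childMinLabels cs)
  childMinLabels-embed S []       = refl
  childMinLabels-embed S (c ∷ cs) = cong₂ _∷_ (minLabel-embed S c) (childMinLabels-embed S cs)

  childMinLabels≤n : ∀ {n j} (cs : Vec (PTree k n) j) → All (_≤ n) (childMinLabels cs)
  childMinLabels≤n []       = []
  childMinLabels≤n (c ∷ cs) = minLabel≤n c ∷ childMinLabels≤n cs

  sorted-embed : ∀ {n j} (S : Subset n) (cs : Vec (PTree k ∣ S ∣) j) →
                 sorted (childMinLabels (relabelⱽ (embed S) cs)) ≡ sorted (childMinLabels cs)
  sorted-embed S cs = trans (cong sorted (childMinLabels-embed S cs)) (sorted-map-embedℕ S _ (childMinLabels≤n cs))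

  mutual
    canonical-embed : ∀ {n} (S : Subset n) (T : PTree k ∣ S ∣) → canonical (relabel (embed S) T) ≡ canonical T
    canonical-embed S (leaf x)  = refl
    canonical-embed S (node cs) = cong₂ _∧_ (canonicalV-embed S cs) (sorted-embed S cs)

    canonicalV-embed : ∀ {n j} (S : Subset n) (cs : Vec (PTree k ∣ S ∣) j) → canonicalV (relabelⱽ (embed S) cs) ≡ canonicalV cs
    canonicalV-embed S []       = refl
    canonicalV-embed S (c ∷ cs) = cong₂ _∧_ (canonical-embed S c) (canonicalV-embed S cs)

  enumerates-embed : ∀ {n} (S : Subset n) l → enumerates S (List.map (embed S) l) ≡ enumerates ⊤ l
  enumerates-embed S l = ≡true-ext
    (λ e → ⇒enumerates (restricted (enumerates⇒ e)))
    (λ e → ⇒enumerates (extended (enumerates⇒ e)))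
    where
    occurrences-embed : ∀ y → occurrences (embed S y) (List.map (embed S) l) ≡ occurrences y l
    occurrences-embed y = occurrences-map-injective (embed S) (embed-injective S) y l
    restricted : Enumerates S (List.map (embed S) l) → Enumerates ⊤ l
    restricted e = enumerating λ y → begin
      occurrences y l                                 ≡⟨ occurrences-embed y ⟨
      occurrences (embed S y) (List.map (embed S) l)  ≡⟨ occurrences≡χ e (embed S y) ⟩
      χ S (embed S y)                                 ≡⟨ cong (λ b → if b then 1 else 0) (embed-∈ S y) ⟩
      1                                               ≡⟨ χ-⊤ y ⟨
      χ ⊤ y                                           ∎
      where open ≡-Reasoning
    extended : Enumerates ⊤ l → Enumerates S (List.map (embed S) l)
    extended e = enumerating counts
      where
      counts : ∀ x → occurrences x (List.map (embed S) l) ≡ χ S x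
      counts x with lookup S x in x∈S
      ... | false = occurrences-map-∉ (embed S) x
                      (λ y embed≡x → true≢false (trans (sym (embed-∈ S y)) (trans (cong (lookup S) embed≡x) x∈S))) l
      ... | true  = begin
        occurrences x (List.map (embed S) l)            ≡⟨ cong (λ z → occurrences z (List.map (embed S) l)) (embed-index S x x∈S) ⟨
        occurrences (embed S y) (List.map (embed S) l)  ≡⟨ occurrences-embed y ⟩
        occurrences y l                                 ≡⟨ occurrences≡χ e y ⟩
        χ ⊤ y                                           ≡⟨ χ-⊤ y ⟩
        1                                               ∎
        where
        open ≡-Reasoning
        y = index S x x∈S

  isPhyloOn : ∀ {n} → Subset n → PTree k n → Bool
  isPhyloOn S T = enumerates S (leaves T) ∧ canonical T

  isForestOn : ∀ {n j} → Subset n → Vec (PTree k n) j → Bool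
  isForestOn S cs = enumerates S (leavesV cs) ∧ (canonicalV cs ∧ sorted (childMinLabels cs))

  PhyloOn : ∀ {n} → Subset n → Set
  PhyloOn {n} S = Σ (PTree k n) (λ T → isPhyloOn S T ≡ true)

  -- Children are sorted by minimal label, so ForestOn j S models unordered forests of j trees partitioning S.
  ForestOn : ∀ {n} → ℕ → Subset n → Set
  ForestOn {n} j S = Σ (Vec (PTree k n) j) (λ cs → isForestOn S cs ≡ true)

  module _ {n} {S : Subset n} where

    phylo-enumerates : (X : PhyloOn S) → Enumerates S (leaves (proj₁ X))
    phylo-enumerates (T , v) = enumerates⇒ (∧-trueˡ v)

    phylo-canonical : (X : PhyloOn S) → canonical (proj₁ X) ≡ true
    phylo-canonical (T , v) = ∧-trueʳ {enumerates S (leaves T)} v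

    mkPhylo : ∀ T → Enumerates S (leaves T) → canonical T ≡ true → PhyloOn S
    mkPhylo T e c = T , cong₂ _∧_ (⇒enumerates e) c

    forest-enumerates : ∀ {j} (F : ForestOn j S) → Enumerates S (leavesV (proj₁ F))
    forest-enumerates (cs , v) = enumerates⇒ (∧-trueˡ v)

    forest-canonical : ∀ {j} (F : ForestOn j S) → canonicalV (proj₁ F) ≡ true
    forest-canonical (cs , v) = ∧-trueˡ (∧-trueʳ {enumerates S (leavesV cs)} v)

    forest-sorted : ∀ {j} (F : ForestOn j S) → sorted (childMinLabels (proj₁ F)) ≡ true
    forest-sorted (cs , v) = ∧-trueʳ {canonicalV cs} (∧-trueʳ {enumerates S (leavesV cs)} v)

    mkForest : ∀ {j} (cs : Vec (PTree k n) j) → Enumerates S (leavesV cs) → canonicalV cs ≡ true →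
               sorted (childMinLabels cs) ≡ true → ForestOn j S
    mkForest cs e c s = cs , cong₂ _∧_ (⇒enumerates e) (cong₂ _∧_ c s)

  isPhyloOn-embed : ∀ {n} (S : Subset n) T → isPhyloOn S (relabel (embed S) T) ≡ isPhyloOn ⊤ T
  isPhyloOn-embed S T =
    cong₂ _∧_ (trans (cong (enumerates S) (leaves-relabel (embed S) T)) (enumerates-embed S (leaves T))) (canonical-embed S T)

  isForestOn-embed : ∀ {n j} (S : Subset n) (cs : Vec (PTree k ∣ S ∣) j) →
                     isForestOn S (relabelⱽ (embed S) cs) ≡ isForestOn ⊤ cs
  isForestOn-embed S cs =
    cong₂ _∧_ (trans (cong (enumerates S) (leavesV-relabelⱽ (embed S) cs)) (enumerates-embed S (leavesV cs)))
              (cong₂ _∧_ (canonicalV-embed S cs) (sorted-embed S cs))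

  mutual
    restrict : ∀ {n} (S : Subset n) (T : PTree k n) → All (λ x → lookup S x ≡ true) (leaves T) → PTree k ∣ S ∣
    restrict S (leaf x)  (x∈S ∷ []) = leaf (index S x x∈S)
    restrict S (node cs) cs⊆S        = node (restrictⱽ S cs cs⊆S)

    restrictⱽ : ∀ {n j} (S : Subset n) (cs : Vec (PTree k n) j) → All (λ x → lookup S x ≡ true) (leavesV cs) →
                Vec (PTree k ∣ S ∣) j
    restrictⱽ S []       _     = []
    restrictⱽ S (c ∷ cs) cs⊆S = restrict S c (++⁻ˡ (leaves c) cs⊆S) ∷ restrictⱽ S cs (++⁻ʳ (leaves c) cs⊆S)

  mutual
    embed-restrict : ∀ {n} (S : Subset n) T T⊆S → relabel (embed S) (restrict S T T⊆S) ≡ T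
    embed-restrict S (leaf x)  (x∈S ∷ []) = cong leaf (embed-index S x x∈S)
    embed-restrict S (node cs) cs⊆S       = cong node (embed-restrictⱽ S cs cs⊆S)

    embed-restrictⱽ : ∀ {n j} (S : Subset n) (cs : Vec (PTree k n) j) cs⊆S → relabelⱽ (embed S) (restrictⱽ S cs cs⊆S) ≡ cs
    embed-restrictⱽ S []       _    = refl
    embed-restrictⱽ S (c ∷ cs) cs⊆S = cong₂ _∷_ (embed-restrict S c _) (embed-restrictⱽ S cs _)

  mutual
    restrict-embed : ∀ {n} (S : Subset n) T T⊆S → restrict S (relabel (embed S) T) T⊆S ≡ T
    restrict-embed S (leaf y)  (y∈S ∷ []) = cong leaf (index-embed S y y∈S)
    restrict-embed S (node cs) cs⊆S       = cong node (restrict-embedⱽ S cs cs⊆S)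

    restrict-embedⱽ : ∀ {n j} (S : Subset n) (cs : Vec (PTree k ∣ S ∣) j) cs⊆S →
                      restrictⱽ S (relabelⱽ (embed S) cs) cs⊆S ≡ cs
    restrict-embedⱽ S []       _    = refl
    restrict-embedⱽ S (c ∷ cs) cs⊆S = cong₂ _∷_ (restrict-embed S c _) (restrict-embedⱽ S cs _)

  PhyloOn-embed : ∀ {n} (S : Subset n) → PhyloOn (⊤ {∣ S ∣}) ↔ PhyloOn S
  PhyloOn-embed S = Σ-≡true-↔ (isPhyloOn ⊤) (isPhyloOn S) (relabel (embed S))
    (λ T v → restrict S T (Enumerates⇒⊆ (phylo-enumerates {S = S} (T , v))))
    (isPhyloOn-embed S) (λ T _ → embed-restrict S T _) (λ T _ → restrict-embed S T _)

  ForestOn-embed : ∀ {n} j (S : Subset n) → ForestOn j (⊤ {∣ S ∣}) ↔ ForestOn j S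
  ForestOn-embed j S = Σ-≡true-↔ (isForestOn ⊤) (isForestOn S) (relabelⱽ (embed S))
    (λ cs v → restrictⱽ S cs (Enumerates⇒⊆ (forest-enumerates {S = S} (cs , v))))
    (isForestOn-embed S) (λ cs _ → embed-restrictⱽ S cs _) (λ cs _ → restrict-embedⱽ S cs _)

module SortedInsertion (k₀ : ℕ) where

  open import Data.Nat as ℕ using (zero; suc; _+_; _≤_; _<_; _⊓_; _<ᵇ_; s≤s)
  open import Data.Nat.Properties as ℕ using (<-trans; <⇒≤; <-cmp; ⊓-sel; m≤n⇒m⊓n≡m; m≤m+n; +-commutativeSemigroup)
  open import Data.Fin using (Fin; zero; suc; toℕ)
  open import Data.Fin.Properties using (toℕ-injective; toℕ<n)
  open import Data.Fin.Subset using (Subset; ⊤; ∁)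
  open import Data.Vec as Vec using (Vec; []; _∷_; lookup; removeAt)
  open import Data.Vec.Properties using (lookup∘tabulate; lookup-map; tabulate-cong; tabulate∘lookup)
  open import Data.List as List using (List; []; _∷_; _++_; foldr)
  open import Data.List.Membership.Propositional using (_∈_)
  open import Data.List.Membership.Propositional.Properties using (∈-++⁺ˡ; ∈-++⁺ʳ)
  open import Data.List.Relation.Unary.Any using (here; there)
  open import Data.List.Relation.Unary.All as All using (All)
  open import Data.Bool using (Bool; true; false; if_then_else_; _∧_; not)
  open import Data.Bool.Properties using (∧-commutativeMonoid; not-involutive)
  open import Algebra.Bundles using (CommutativeMonoid)
  open import Data.Product using (Σ; _×_; _,_; proj₁)
  open import Data.Sum using (inj₁; inj₂)
  open import Function.Bundles using (_↔_; mk↔ₛ′)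
  open import Relation.Nullary using (¬_; contradiction)
  open import Relation.Binary using (tri<; tri≈; tri>)
  open import Relation.Binary.PropositionalEquality
  open import Algebra.Properties.CommutativeSemigroup +-commutativeSemigroup
    using () renaming (x∙yz≈y∙xz to +-exchange)
  open import Algebra.Properties.CommutativeSemigroup (CommutativeMonoid.commutativeSemigroup ∧-commutativeMonoid)
    using () renaming (x∙yz≈y∙xz to ∧-exchange)
  open BooleanFacts
  open Occurrences
  open TreesOnSubsets (suc k₀)

  private
    k = suc k₀

  module _ {n : ℕ} where

    private
      Tree = PTree k n

    insert : ∀ {p} → Tree → Vec Tree p → Vec Tree (suc p)
    insert x []       = x ∷ []
    insert x (y ∷ ys) = if minLabel y <ᵇ minLabel x then y ∷ insert x ys else x ∷ y ∷ ys

    insertPos : ∀ {p} → Tree → Vec Tree p → Fin (suc p)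
    insertPos x []       = zero
    insertPos x (y ∷ ys) = if minLabel y <ᵇ minLabel x then suc (insertPos x ys) else zero

    lookup-insert : ∀ {p} x (ys : Vec Tree p) → lookup (insert x ys) (insertPos x ys) ≡ x
    lookup-insert x []       = refl
    lookup-insert x (y ∷ ys) with minLabel y <ᵇ minLabel x
    ... | true  = lookup-insert x ys
    ... | false = refl

    removeAt-insert : ∀ {p} x (ys : Vec Tree p) → removeAt (insert x ys) (insertPos x ys) ≡ ys
    removeAt-insert x []       = refl
    removeAt-insert x (y ∷ ys) with minLabel y <ᵇ minLabel x
    ... | false = refl
    ... | true  = trans (removeAt-suc y (insert x ys) (insertPos x ys)) (cong (y ∷_) (removeAt-insert x ys))
      where
      removeAt-suc : ∀ {m} (y : Tree) (zs : Vec Tree (suc m)) i → removeAt (y ∷ zs) (suc i) ≡ y ∷ removeAt zs i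
      removeAt-suc y (z ∷ zs) i = refl

    sorted-tail : ∀ a L → sorted (a ∷ L) ≡ true → sorted L ≡ true
    sorted-tail a []      _ = refl
    sorted-tail a (b ∷ L) s = ∧-trueʳ {a <ᵇ b} s

    sorted-skip : ∀ a b L → sorted (a ∷ b ∷ L) ≡ true → sorted (a ∷ L) ≡ true
    sorted-skip a b []      _ = refl
    sorted-skip a b (c ∷ L) s = cong₂ _∧_
      (<⇒<ᵇ≡true {a} {c} (<-trans (<ᵇ≡true⇒< {a} {b} (∧-trueˡ s)) (<ᵇ≡true⇒< {b} {c} (∧-trueˡ (∧-trueʳ {a <ᵇ b} s)))))
      (∧-trueʳ {b <ᵇ c} (∧-trueʳ {a <ᵇ b} s))

    sorted-head-< : ∀ {p} b (zs : Vec Tree p) → sorted (b ∷ childMinLabels zs) ≡ true → ∀ a → b < minLabel (lookup zs a)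
    sorted-head-< b (z ∷ zs) s zero    = <ᵇ≡true⇒< (∧-trueˡ s)
    sorted-head-< b (z ∷ zs) s (suc a) = sorted-head-< b zs (sorted-skip b (minLabel z) (childMinLabels zs) s) a

    ≮∧≢⇒> : ∀ {a b} → (b <ᵇ a) ≡ false → ¬ b ≡ a → a < b
    ≮∧≢⇒> {a} {b} b≮a b≢a with <-cmp a b
    ... | tri< a<b _ _ = a<b
    ... | tri≈ _ a≡b _ = contradiction (sym a≡b) b≢a
    ... | tri> _ _ b<a = contradiction (trans (sym b≮a) (<⇒<ᵇ≡true b<a)) (λ ())

    MinLabelFree : ∀ {p} → Tree → Vec Tree p → Set
    MinLabelFree x ys = ∀ a → ¬ minLabel (lookup ys a) ≡ minLabel x

    sorted-insert-below : ∀ {p} b x (ys : Vec Tree p) → b < minLabel x → MinLabelFree x ys →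
                          sorted (b ∷ childMinLabels ys) ≡ true → sorted (b ∷ childMinLabels (insert x ys)) ≡ true
    sorted-insert-below b x []       b<x _    _ = cong₂ _∧_ (<⇒<ᵇ≡true b<x) refl
    sorted-insert-below b x (y ∷ ys) b<x free s with minLabel y <ᵇ minLabel x in y<x
    ... | true  = cong₂ _∧_ (∧-trueˡ s)
                    (sorted-insert-below (minLabel y) x ys (<ᵇ≡true⇒< y<x) (λ a → free (suc a)) s')
      where s' : sorted (minLabel y ∷ childMinLabels ys) ≡ true
            s' = sorted-tail b (minLabel y ∷ childMinLabels ys) s
    ... | false = cong₂ _∧_ (<⇒<ᵇ≡true b<x) (cong₂ _∧_ (<⇒<ᵇ≡true (≮∧≢⇒> y<x (free zero))) s')
      where s' : sorted (minLabel y ∷ childMinLabels ys) ≡ true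
            s' = sorted-tail b (minLabel y ∷ childMinLabels ys) s

    sorted-insert : ∀ {p} x (ys : Vec Tree p) → MinLabelFree x ys →
                    sorted (childMinLabels ys) ≡ true → sorted (childMinLabels (insert x ys)) ≡ true
    sorted-insert x []       _    _ = refl
    sorted-insert x (y ∷ ys) free s with minLabel y <ᵇ minLabel x in y<x
    ... | true  = sorted-insert-below (minLabel y) x ys (<ᵇ≡true⇒< y<x) (λ a → free (suc a)) s
    ... | false = cong₂ _∧_ (<⇒<ᵇ≡true (≮∧≢⇒> y<x (free zero))) s

    sorted-removeAt-below : ∀ {p} b (zs : Vec Tree (suc p)) a →
                            sorted (b ∷ childMinLabels zs) ≡ true → sorted (b ∷ childMinLabels (removeAt zs a)) ≡ true
    sorted-removeAt-below b (z ∷ zs)      zero    s = sorted-skip b (minLabel z) (childMinLabels zs) s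
    sorted-removeAt-below b (z ∷ z' ∷ zs) (suc a) s =
      cong₂ _∧_ (∧-trueˡ s) (sorted-removeAt-below (minLabel z) (z' ∷ zs) a (∧-trueʳ {b <ᵇ minLabel z} s))

    sorted-removeAt : ∀ {p} (zs : Vec Tree (suc p)) a → sorted (childMinLabels zs) ≡ true →
                      sorted (childMinLabels (removeAt zs a)) ≡ true
    sorted-removeAt (z ∷ zs)      zero    s = sorted-tail (minLabel z) (childMinLabels zs) s
    sorted-removeAt (z ∷ z' ∷ zs) (suc a) s = sorted-removeAt-below (minLabel z) (z' ∷ zs) a s

    head-≮-second : ∀ {p} z z' (zs : Vec Tree p) → sorted (childMinLabels (z ∷ z' ∷ zs)) ≡ true →
                    (minLabel z' <ᵇ minLabel z) ≡ false
    head-≮-second z z' zs s = ≥⇒<ᵇ≡false {minLabel z'} {minLabel z} (<⇒≤ (<ᵇ≡true⇒< (∧-trueˡ s)))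

    head-<-lookup : ∀ {p} z (zs : Vec Tree p) a → sorted (childMinLabels (z ∷ zs)) ≡ true →
                    (minLabel z <ᵇ minLabel (lookup zs a)) ≡ true
    head-<-lookup z zs a s = <⇒<ᵇ≡true (sorted-head-< (minLabel z) zs s a)

    insertPos-removeAt : ∀ {p} (zs : Vec Tree (suc p)) a → sorted (childMinLabels zs) ≡ true →
                         insertPos (lookup zs a) (removeAt zs a) ≡ a
    insertPos-removeAt (z ∷ [])      zero    s = refl
    insertPos-removeAt (z ∷ z' ∷ zs) zero    s rewrite head-≮-second z z' zs s    = refl
    insertPos-removeAt (z ∷ z' ∷ zs) (suc a) s rewrite head-<-lookup z (z' ∷ zs) a s =
      cong suc (insertPos-removeAt (z' ∷ zs) a (sorted-tail (minLabel z) (childMinLabels (z' ∷ zs)) s))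

    insert-removeAt : ∀ {p} (zs : Vec Tree (suc p)) a → sorted (childMinLabels zs) ≡ true →
                      insert (lookup zs a) (removeAt zs a) ≡ zs
    insert-removeAt (z ∷ [])      zero    s = refl
    insert-removeAt (z ∷ z' ∷ zs) zero    s rewrite head-≮-second z z' zs s    = refl
    insert-removeAt (z ∷ z' ∷ zs) (suc a) s rewrite head-<-lookup z (z' ∷ zs) a s =
      cong (z ∷_) (insert-removeAt (z' ∷ zs) a (sorted-tail (minLabel z) (childMinLabels (z' ∷ zs)) s))

    occurrences-insert : ∀ {p} z x (ys : Vec Tree p) →
                         occurrences z (leavesV (insert x ys)) ≡ occurrences z (leaves x) + occurrences z (leavesV ys)
    occurrences-insert z x []       = occurrences-++ z (leaves x) []
    occurrences-insert z x (y ∷ ys) with minLabel y <ᵇ minLabel x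
    ... | false = occurrences-++ z (leaves x) (leavesV (y ∷ ys))
    ... | true  = begin
      # (leaves y ++ leavesV (insert x ys))        ≡⟨ occurrences-++ z (leaves y) _ ⟩
      # (leaves y) + # (leavesV (insert x ys))     ≡⟨ cong (# (leaves y) +_) (occurrences-insert z x ys) ⟩
      # (leaves y) + (# (leaves x) + # (leavesV ys)) ≡⟨ +-exchange (# (leaves y)) (# (leaves x)) (# (leavesV ys)) ⟩
      # (leaves x) + (# (leaves y) + # (leavesV ys)) ≡⟨ cong (# (leaves x) +_) (occurrences-++ z (leaves y) (leavesV ys)) ⟨
      # (leaves x) + # (leavesV (y ∷ ys))          ∎
      where
      open ≡-Reasoning
      # = occurrences z

    occurrences-removeAt : ∀ {p} z (zs : Vec Tree (suc p)) a →
      occurrences z (leavesV zs) ≡ occurrences z (leaves (lookup zs a)) + occurrences z (leavesV (removeAt zs a))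
    occurrences-removeAt z (y ∷ zs)      zero    = occurrences-++ z (leaves y) (leavesV zs)
    occurrences-removeAt z (y ∷ y' ∷ zs) (suc a) = begin
      # (leaves y ++ leavesV (y' ∷ zs))                ≡⟨ occurrences-++ z (leaves y) _ ⟩
      # (leaves y) + # (leavesV (y' ∷ zs))             ≡⟨ cong (# (leaves y) +_) (occurrences-removeAt z (y' ∷ zs) a) ⟩
      # (leaves y) + (# (leaves x) + # (leavesV rest)) ≡⟨ +-exchange (# (leaves y)) (# (leaves x)) (# (leavesV rest)) ⟩
      # (leaves x) + (# (leaves y) + # (leavesV rest)) ≡⟨ cong (# (leaves x) +_) (occurrences-++ z (leaves y) (leavesV rest)) ⟨
      # (leaves x) + # (leavesV (y ∷ rest))            ∎
      where
      open ≡-Reasoning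
      # = occurrences z
      x = lookup (y' ∷ zs) a
      rest = removeAt (y' ∷ zs) a

    canonicalV-insert : ∀ {p} x (ys : Vec Tree p) → canonicalV (insert x ys) ≡ canonical x ∧ canonicalV ys
    canonicalV-insert x []       = refl
    canonicalV-insert x (y ∷ ys) with minLabel y <ᵇ minLabel x
    ... | true  = trans (cong (canonical y ∧_) (canonicalV-insert x ys)) (∧-exchange (canonical y) (canonical x) _)
    ... | false = refl

    canonicalV-removeAt : ∀ {p} (zs : Vec Tree (suc p)) a → canonicalV zs ≡ canonical (lookup zs a) ∧ canonicalV (removeAt zs a)
    canonicalV-removeAt (y ∷ zs)      zero    = refl
    canonicalV-removeAt (y ∷ y' ∷ zs) (suc a) = trans (cong (canonical y ∧_) (canonicalV-removeAt (y' ∷ zs) a))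
      (∧-exchange (canonical y) (canonical (lookup (y' ∷ zs) a)) (canonicalV (removeAt (y' ∷ zs) a)))

    foldr-⊓-attained : ∀ (y : Fin n) l → Σ (Fin n) (λ z → z ∈ y ∷ l × foldr _⊓_ n (List.map toℕ (y ∷ l)) ≡ toℕ z)
    foldr-⊓-attained y []       = y , here refl , m≤n⇒m⊓n≡m (<⇒≤ (toℕ<n y))
    foldr-⊓-attained y (y' ∷ l) with foldr-⊓-attained y' l | ⊓-sel (toℕ y) (foldr _⊓_ n (List.map toℕ (y' ∷ l)))
    ... | _ , _   , _     | inj₁ min≡y    = y , here refl , min≡y
    ... | z , z∈l , min≡z | inj₂ min≡rest = z , there z∈l , trans min≡rest min≡z

    leaves-nonempty : (T : Tree) → Σ (Fin n) (λ y → Σ (List (Fin n)) (λ l → leaves T ≡ y ∷ l))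
    leaves-nonempty (leaf x)        = x , [] , refl
    leaves-nonempty (node (c ∷ cs)) with leaves-nonempty c
    ... | y , l , leaves≡ = y , l ++ leavesV cs , cong (_++ leavesV cs) leaves≡

    minLabel-attained : (T : Tree) → Σ (Fin n) (λ z → z ∈ leaves T × minLabel T ≡ toℕ z)
    minLabel-attained T with leaves-nonempty T
    ... | y , l , leaves≡ =
      subst (λ l → Σ (Fin n) (λ z → z ∈ l × foldr _⊓_ n (List.map toℕ l) ≡ toℕ z)) (sym leaves≡) (foldr-⊓-attained y l)

    ∈-leavesV-lookup : ∀ {p} {z} (ys : Vec Tree p) a → z ∈ leaves (lookup ys a) → z ∈ leavesV ys
    ∈-leavesV-lookup (y ∷ ys) zero    z∈y = ∈-++⁺ˡ z∈y
    ∈-leavesV-lookup (y ∷ ys) (suc a) z∈y = ∈-++⁺ʳ (leaves y) (∈-leavesV-lookup ys a z∈y)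

    -- Minimal labels are leaf labels, and the leaf sets of x and of ys are disjoint.
    minLabel-free : ∀ {p S} (x : PhyloOn S) (ys : ForestOn p (∁ S)) → MinLabelFree (proj₁ x) (proj₁ ys)
    minLabel-free {S = S} x ys a x≡y with minLabel-attained (proj₁ x) | minLabel-attained (lookup (proj₁ ys) a)
    ... | zx , zx∈x , x≡zx | zy , zy∈y , y≡zy = true≢false (begin
      true                  ≡⟨ All.lookup (Enumerates⇒⊆ (phylo-enumerates {S = S} x)) zx∈x ⟨
      lookup S zx           ≡⟨ cong (lookup S) (toℕ-injective (trans (sym x≡zx) (trans (sym x≡y) y≡zy))) ⟩
      lookup S zy           ≡⟨ not-involutive _ ⟨
      not (not (lookup S zy)) ≡⟨ cong not (lookup-map zy not S) ⟨
      not (lookup (∁ S) zy) ≡⟨ cong not (All.lookup (Enumerates⇒⊆ (forest-enumerates {S = ∁ S} ys))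
                                                     (∈-leavesV-lookup (proj₁ ys) a zy∈y)) ⟩
      false                 ∎)
      where open ≡-Reasoning

    leafSet : Tree → Subset n
    leafSet x = Vec.tabulate (λ z → 0 <ᵇ occurrences z (leaves x))

    χ-leafSet : ∀ x z → occurrences z (leaves x) ≤ 1 → χ (leafSet x) z ≡ occurrences z (leaves x)
    χ-leafSet x z ≤1 rewrite lookup∘tabulate (λ z → 0 <ᵇ occurrences z (leaves x)) z with occurrences z (leaves x) | ≤1
    ... | 0 | _       = refl
    ... | 1 | _       = refl
    ... | suc (suc _) | s≤s ()

    χ-∁-leafSet : ∀ x z c → occurrences z (leaves x) + c ≡ 1 → χ (∁ (leafSet x)) z ≡ c
    χ-∁-leafSet x z c total rewrite lookup-map z not (leafSet x) | lookup∘tabulate (λ z → 0 <ᵇ occurrences z (leaves x)) z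
      with occurrences z (leaves x) | total
    ... | 0 | refl = refl
    ... | 1 | refl = refl

    PointedForest : ℕ → Set
    PointedForest p = Fin (suc p) × ForestOn (suc p) (⊤ {n})

    SplitForest : ℕ → Set
    SplitForest p = Σ (Subset n) (λ S → PhyloOn S × ForestOn p (∁ S))

    split : ∀ {p} → PointedForest p → SplitForest p
    split (a , F@(zs , _)) = leafSet x , (mkPhylo x ex cx , mkForest ys eys cys (sorted-removeAt zs a (forest-sorted {S = ⊤} F)))
      where
      x  = lookup zs a
      ys = removeAt zs a
      total : ∀ z → occurrences z (leaves x) + occurrences z (leavesV ys) ≡ 1
      total z = trans (sym (occurrences-removeAt z zs a)) (trans (occurrences≡χ (forest-enumerates {S = ⊤} F) z) (χ-⊤ z))
      ex : Enumerates (leafSet x) (leaves x)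
      ex = enumerating λ z → sym (χ-leafSet x z (subst (occurrences z (leaves x) ≤_) (total z) (m≤m+n _ _)))
      eys : Enumerates (∁ (leafSet x)) (leavesV ys)
      eys = enumerating λ z → sym (χ-∁-leafSet x z _ (total z))
      cx∧cys : canonical x ∧ canonicalV ys ≡ true
      cx∧cys = trans (sym (canonicalV-removeAt zs a)) (forest-canonical {S = ⊤} F)
      cx  = ∧-trueˡ cx∧cys
      cys = ∧-trueʳ {canonical x} cx∧cys

    merge : ∀ {p} → SplitForest p → PointedForest p
    merge (S , (X@(x , _) , Y@(ys , _))) = insertPos x ys , mkForest (insert x ys) e c s
      where
      e : Enumerates ⊤ (leavesV (insert x ys))
      e = enumerating λ z → begin
        occurrences z (leavesV (insert x ys))                  ≡⟨ occurrences-insert z x ys ⟩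
        occurrences z (leaves x) + occurrences z (leavesV ys)  ≡⟨ cong₂ _+_ (occurrences≡χ (phylo-enumerates {S = S} X) z)
                                                                            (occurrences≡χ (forest-enumerates {S = ∁ S} Y) z) ⟩
        χ S z + χ (∁ S) z                                      ≡⟨ χ+χ-∁ S z ⟩
        1                                                      ≡⟨ χ-⊤ z ⟨
        χ ⊤ z                                                  ∎
        where open ≡-Reasoning
      c : canonicalV (insert x ys) ≡ true
      c = trans (canonicalV-insert x ys) (cong₂ _∧_ (phylo-canonical {S = S} X) (forest-canonical {S = ∁ S} Y))
      s : sorted (childMinLabels (insert x ys)) ≡ true
      s = sorted-insert x ys (minLabel-free {S = S} X Y) (forest-sorted {S = ∁ S} Y)

    leafSet-enumerated : ∀ {S x} → Enumerates S (leaves x) → leafSet x ≡ S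
    leafSet-enumerated {S} e = trans (tabulate-cong λ z → trans (cong (0 <ᵇ_) (occurrences≡χ e z)) (0<χ z)) (tabulate∘lookup S)
      where
      0<χ : ∀ z → (0 <ᵇ χ S z) ≡ lookup S z
      0<χ z with lookup S z
      ... | true  = refl
      ... | false = refl

    SplitForest-≡ : ∀ {p S S' x x' ys ys'} → S ≡ S' → proj₁ x ≡ proj₁ x' → proj₁ ys ≡ proj₁ ys' →
                    _≡_ {A = SplitForest p} (S , (x , ys)) (S' , (x' , ys'))
    SplitForest-≡ {S = S} {x = _ , vx} {_ , vx'} {_ , vy} {_ , vy'} refl refl refl =
      cong₂ (λ vx vy → S , ((_ , vx) , (_ , vy))) (≡true-irrelevant vx vx') (≡true-irrelevant vy vy')

    merge∘split : ∀ {p} (P : PointedForest p) → merge (split P) ≡ P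
    merge∘split (a , F@(zs , v)) = cong₂ _,_ (insertPos-removeAt zs a s) (Σ-≡true-≡ (isForestOn ⊤) (insert-removeAt zs a s) _ _)
      where s = forest-sorted {S = ⊤} F

    split∘merge : ∀ {p} (Q : SplitForest p) → split (merge Q) ≡ Q
    split∘merge (S , (X@(x , _) , (ys , _))) = SplitForest-≡
      (trans (cong leafSet (lookup-insert x ys)) (leafSet-enumerated {x = x} (phylo-enumerates {S = S} X)))
      (lookup-insert x ys) (removeAt-insert x ys)

    PointedForest↔SplitForest : ∀ p → PointedForest p ↔ SplitForest p
    PointedForest↔SplitForest p = mk↔ₛ′ split merge split∘merge merge∘split

module FiniteCounting where

  open import Data.Nat using (zero; suc; _+_; _*_)
  open import Data.Fin using (zero; suc)
  open import Data.Fin.Properties using (+↔⊎; *↔×)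
  open import Data.Fin.Permutation using (↔⇒≡)
  open import Data.Fin.Subset using (Subset; ∣_∣; ∁)
  open import Data.Vec using ([]; _∷_)
  open import Data.Bool using (Bool; true; false)
  open import Data.Product using (Σ; _×_; _,_; proj₁; proj₂)
  open import Data.Sum using (_⊎_; inj₁; inj₂)
  open import Data.Empty using (⊥-elim)
  open import Relation.Nullary using (¬_)
  open import Relation.Binary.PropositionalEquality
  open import Function.Bundles using (mk↔ₛ′; Inverse)
  open import Function.Properties.Inverse using (↔-refl; ↔-sym; ↔-trans)
  open import Data.Sum.Function.Propositional using (_⊎-↔_)
  open import Data.Product.Function.NonDependent.Propositional using (_×-↔_)
  open SplitSum
  open BooleanFacts

  Σ-Subset-suc : ∀ {n} (B : Subset (suc n) → Set) →
                 Σ (Subset (suc n)) B ↔ (Σ (Subset n) (λ S → B (true ∷ S)) ⊎ Σ (Subset n) (λ S → B (false ∷ S)))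
  Σ-Subset-suc B = mk↔ₛ′ to from to∘from from∘to
    where
    to : Σ _ B → _
    to (true ∷ S  , b) = inj₁ (S , b)
    to (false ∷ S , b) = inj₂ (S , b)
    from : _ → Σ _ B
    from (inj₁ (S , b)) = true ∷ S , b
    from (inj₂ (S , b)) = false ∷ S , b
    to∘from : ∀ y → to (from y) ≡ y
    to∘from (inj₁ _) = refl
    to∘from (inj₂ _) = refl
    from∘to : ∀ x → from (to x) ≡ x
    from∘to (true ∷ S  , _) = refl
    from∘to (false ∷ S , _) = refl

  Fin-splitSum↔Σ : ∀ n (B : Subset n → Set) F → (∀ S → Fin (F ∣ S ∣ ∣ ∁ S ∣) ↔ B S) →
                   Fin (splitSum n F) ↔ Σ (Subset n) B
  Fin-splitSum↔Σ zero    B F count = ↔-trans (count []) (mk↔ₛ′ ([] ,_) (λ { ([] , b) → b }) (λ { ([] , b) → refl }) (λ _ → refl))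
  Fin-splitSum↔Σ (suc n) B F count = ↔-trans +↔⊎ (↔-trans
    (Fin-splitSum↔Σ n (λ S → B (true ∷ S))  (λ a b → F (suc a) b) (λ S → count (true ∷ S)) ⊎-↔
     Fin-splitSum↔Σ n (λ S → B (false ∷ S)) (λ a b → F a (suc b)) (λ S → count (false ∷ S)))
    (↔-sym (Σ-Subset-suc B)))

  Fin0↔ : ∀ {A : Set} → ¬ A → Fin 0 ↔ A
  Fin0↔ ¬a = mk↔ₛ′ (λ ()) (λ a → ⊥-elim (¬a a)) (λ a → ⊥-elim (¬a a)) (λ ())

  Σ-Fin-suc : ∀ {c} (A : Fin (suc c) → Set) → Σ (Fin (suc c)) A ↔ (A zero ⊎ Σ (Fin c) (λ z → A (suc z)))
  Σ-Fin-suc A = mk↔ₛ′ to from to∘from from∘to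
    where
    to : Σ _ A → _
    to (zero  , a) = inj₁ a
    to (suc z , a) = inj₂ (z , a)
    from : _ → Σ _ A
    from (inj₁ a)       = zero , a
    from (inj₂ (z , a)) = suc z , a
    to∘from : ∀ y → to (from y) ≡ y
    to∘from (inj₁ _) = refl
    to∘from (inj₂ _) = refl
    from∘to : ∀ x → from (to x) ≡ x
    from∘to (zero  , _) = refl
    from∘to (suc _ , _) = refl

  countᵇ : ∀ c (P : Fin c → Bool) → Σ ℕ (λ u → Fin u ↔ Σ (Fin c) (λ z → P z ≡ true))
  countᵇ zero    P = 0 , Fin0↔ (λ { (() , _) })
  countᵇ (suc c) P with countᵇ c (λ z → P (suc z))
  ... | u , Fin-u↔ = head + u , ↔-trans +↔⊎ (↔-trans (Fin-head↔ ⊎-↔ Fin-u↔) (↔-sym (Σ-Fin-suc (λ z → P z ≡ true))))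
    where
    head : ℕ
    head with P zero
    ... | true  = 1
    ... | false = 0
    Fin-head↔ : Fin head ↔ (P zero ≡ true)
    Fin-head↔ with P zero
    ... | true  = mk↔ₛ′ (λ _ → refl) (λ _ → zero) (λ { refl → refl }) (λ { zero → refl })
    ... | false = Fin0↔ (λ ())

  isZero : ∀ {p} → Fin (suc p) → Bool
  isZero zero    = true
  isZero (suc _) = false

  isZero⇒≡zero : ∀ {p} (z : Fin (suc p)) → isZero z ≡ true → z ≡ zero
  isZero⇒≡zero zero _ = refl

  -- A is the fibre of the first projection over zero.
  Fin↔Fin×-cancel : ∀ c p (A : Set) → Fin c ↔ (Fin (suc p) × A) → Σ ℕ (λ u → (Fin u ↔ A) × (suc p * u ≡ c))
  Fin↔Fin×-cancel c p A c↔ with countᵇ c (λ z → isZero (proj₁ (Inverse.to c↔ z)))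
  ... | u , Fin-u↔ = u , u↔A , ↔⇒≡ (↔-trans *↔× (↔-trans (↔-refl ×-↔ u↔A) (↔-sym c↔)))
    where
    open Inverse c↔
    fibre↔A : Σ (Fin c) (λ z → isZero (proj₁ (to z)) ≡ true) ↔ A
    fibre↔A = mk↔ₛ′ (λ (z , _) → proj₂ (to z))
      (λ a → from (zero , a) , cong (λ w → isZero (proj₁ w)) (strictlyInverseˡ (zero , a)))
      (λ a → cong proj₂ (strictlyInverseˡ (zero , a)))
      (λ (z , z∈fibre) → Σ-≡true-≡ (λ w → isZero (proj₁ (to w)))
        (trans (cong from (cong (_, proj₂ (to z)) (sym (isZero⇒≡zero _ z∈fibre)))) (strictlyInverseʳ z)) _ _)
    u↔A : Fin u ↔ A
    u↔A = ↔-trans Fin-u↔ fibre↔A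

module RootDecomposition (k₀ : ℕ) where

  open import Data.Nat using (zero; suc; _+_; _*_; _!; _≡ᵇ_)
  open import Data.Nat.Properties using (+-comm; *-comm; *-assoc; +-identityʳ)
  open import Data.Fin using (zero; suc)
  open import Data.Fin.Properties using (+↔⊎; *↔×)
  open import Data.Fin.Permutation using (↔⇒≡)
  open import Data.Fin.Subset using (Subset; ⊤; ∁; ∣_∣)
  open import Data.Vec using ([]; lookup)
  open import Data.List using (allFin)
  open import Data.List.Properties using (map-cong)
  open import Data.Bool using (_∧_)
  open import Data.Bool.ListAction using (and)
  open import Data.Product using (Σ; _×_; _,_; proj₁; proj₂)
  open import Data.Sum using (_⊎_; inj₁; inj₂)
  open import Relation.Binary.PropositionalEquality
  open import Function.Bundles using (mk↔ₛ′)
  open import Function.Properties.Inverse using (↔-refl; ↔-sym; ↔-trans)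
  open import Data.Sum.Function.Propositional using (_⊎-↔_)
  open import Data.Product.Function.NonDependent.Propositional using (_×-↔_)
  open import Data.Product.Function.Dependent.Propositional using (Σ-↔)
  open SplitSum using (δ)
  open ExponentialGeneratingFunctions using (_⋆_; _⋆^_; ⋆-congʳ; *-⋆)
  open BooleanFacts
  open Occurrences
  open FiniteCounting
  open Relabelling (suc k₀)
  open TreesOnSubsets (suc k₀)
  open SortedInsertion k₀

  private
    k = suc k₀

  PhyloTree↔PhyloOn : ∀ n → PhyloTree k n ↔ PhyloOn (⊤ {n})
  PhyloTree↔PhyloOn n = Σ-≡true-↔ _ (isPhyloOn ⊤) (λ T → T) (λ T _ → T)
    (λ T → cong (_∧ canonical T) (cong and (map-cong (λ x → cong (occurrences x (leaves T) ≡ᵇ_) (χ-⊤ x)) (allFin n))))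
    (λ _ _ → refl) (λ _ _ → refl)

  module _ {t : ℕ → ℕ} (Fin-t↔ : ∀ n → Fin (t n) ↔ PhyloTree k n) where

    Fin-t↔PhyloOn : ∀ {n} (S : Subset n) → Fin (t ∣ S ∣) ↔ PhyloOn S
    Fin-t↔PhyloOn S = ↔-trans (Fin-t↔ ∣ S ∣) (↔-trans (PhyloTree↔PhyloOn ∣ S ∣) (PhyloOn-embed S))

    -- A forest of p + 1 trees with one of them distinguished is a tree plus a forest of p trees.
    forestCount : ∀ p → Σ (ℕ → ℕ) (λ u → (∀ l → Fin (u l) ↔ ForestOn p (⊤ {l})) × (∀ l → p ! * u l ≡ (t ⋆^ p) l))
    forestCount zero    = (λ l → δ l 0) , Fin-δ↔ , (λ l → +-identityʳ (δ l 0))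
      where
      Fin-δ↔ : ∀ l → Fin (δ l 0) ↔ ForestOn 0 (⊤ {l})
      Fin-δ↔ zero    = mk↔ₛ′ (λ _ → [] , refl) (λ _ → zero) (λ { ([] , refl) → refl }) (λ { zero → refl })
      Fin-δ↔ (suc l) = Fin0↔ (λ { ([] , ()) })
    forestCount (suc p) with forestCount p
    ... | u , Fin-u↔ , p!u≡t^p = u' , Fin-u'↔ , [1+p]!u'≡t^[1+p]
      where
      Fin-t⋆u↔ : ∀ l → Fin ((t ⋆ u) l) ↔ SplitForest {l} p
      Fin-t⋆u↔ l = Fin-splitSum↔Σ l _ _
        (λ S → ↔-trans *↔× (Fin-t↔PhyloOn S ×-↔ ↔-trans (Fin-u↔ ∣ ∁ S ∣) (ForestOn-embed p (∁ S))))
      quotient : ∀ l → Σ ℕ (λ v → (Fin v ↔ ForestOn (suc p) (⊤ {l})) × (suc p * v ≡ (t ⋆ u) l))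
      quotient l = Fin↔Fin×-cancel _ p _ (↔-trans (Fin-t⋆u↔ l) (↔-sym (PointedForest↔SplitForest p)))
      u' : ℕ → ℕ
      u' l = proj₁ (quotient l)
      Fin-u'↔ : ∀ l → Fin (u' l) ↔ ForestOn (suc p) (⊤ {l})
      Fin-u'↔ l = proj₁ (proj₂ (quotient l))
      [1+p]!u'≡t^[1+p] : ∀ l → suc p ! * u' l ≡ (t ⋆^ suc p) l
      [1+p]!u'≡t^[1+p] l = begin
        (suc p * p !) * u' l  ≡⟨ cong (_* u' l) (*-comm (suc p) (p !)) ⟩
        (p ! * suc p) * u' l  ≡⟨ *-assoc (p !) (suc p) (u' l) ⟩
        p ! * (suc p * u' l)  ≡⟨ cong (p ! *_) (proj₂ (proj₂ (quotient l))) ⟩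
        p ! * (t ⋆ u) l       ≡⟨ *-⋆ (p !) t u l ⟩
        (t ⋆ (λ l → p ! * u l)) l ≡⟨ ⋆-congʳ t p!u≡t^p l ⟩
        (t ⋆ (t ⋆^ p)) l      ∎
        where open ≡-Reasoning

  module _ (i : ℕ) {n : ℕ} where

    MarkedTree : Set
    MarkedTree = Σ (PhyloOn (⊤ {n})) (λ X → HighVertex i (proj₁ X))

    HighRootTree : Set
    HighRootTree = Σ (PhyloOn (⊤ {n})) (λ X → i ≤ rank (proj₁ X))

    MarkedChild : Set
    MarkedChild = Σ (PointedForest {n} k₀) (λ (a , F) → HighVertex i (lookup (proj₁ F) a))

    -- isPhyloOn S (node cs) and isForestOn S cs are the same boolean by definition.
    MarkedTree↔⊎ : MarkedTree ↔ (HighRootTree ⊎ MarkedChild)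
    MarkedTree↔⊎ = mk↔ₛ′ to from to∘from from∘to
      where
      to : MarkedTree → HighRootTree ⊎ MarkedChild
      to ((leaf x  , v) , (here , i≤r))      = inj₁ ((leaf x , v) , i≤r)
      to ((node cs , v) , (here , i≤r))      = inj₁ ((node cs , v) , i≤r)
      to ((node cs , v) , (there a w , i≤r)) = inj₂ ((a , (cs , v)) , (w , i≤r))
      from : HighRootTree ⊎ MarkedChild → MarkedTree
      from (inj₁ (X , i≤r))                     = X , (here , i≤r)
      from (inj₂ ((a , (cs , v)) , (w , i≤r))) = (node cs , v) , (there a w , i≤r)
      to∘from : ∀ y → to (from y) ≡ y
      to∘from (inj₁ ((leaf x , v) , _))  = refl
      to∘from (inj₁ ((node cs , v) , _)) = refl
      to∘from (inj₂ _)                   = refl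
      from∘to : ∀ x → from (to x) ≡ x
      from∘to ((leaf x  , v) , (here , _))    = refl
      from∘to ((node cs , v) , (here , _))    = refl
      from∘to ((node cs , v) , (there _ _ , _)) = refl

    MarkedChild↔Σ : MarkedChild ↔ Σ (Subset n) (λ S → Σ (PhyloOn S) (λ X → HighVertex i (proj₁ X)) × ForestOn k₀ (∁ S))
    MarkedChild↔Σ = ↔-trans (Σ-↔ (PointedForest↔SplitForest k₀) ↔-refl)
      (mk↔ₛ′ (λ ((S , (X , Y)) , w) → S , ((X , w) , Y)) (λ (S , ((X , w) , Y)) → (S , (X , Y)) , w) (λ _ → refl) (λ _ → refl))

  vertexCount : ∀ i (t m r : ℕ → ℕ) (Fin-t↔ : ∀ n → Fin (t n) ↔ PhyloTree k n) →
                (∀ n → Fin (m n) ↔ RankVertex i k n) → (∀ n → Fin (r n) ↔ RankRoot i k n) →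
                ∀ n → m n ≡ (m ⋆ proj₁ (forestCount Fin-t↔ k₀)) n + r n
  vertexCount i t m r Fin-t↔ Fin-m↔ Fin-r↔ n = trans (↔⇒≡ Fin-m↔Fin-r+m⋆u) (+-comm (r n) _)
    where
    u = proj₁ (forestCount Fin-t↔ k₀)
    Fin-u↔ = proj₁ (proj₂ (forestCount Fin-t↔ k₀))
    Fin-m↔Marked : ∀ {l} (S : Subset l) → Fin (m ∣ S ∣) ↔ Σ (PhyloOn S) (λ X → HighVertex i (proj₁ X))
    Fin-m↔Marked S = ↔-trans (Fin-m↔ ∣ S ∣) (↔-trans (Σ-↔ (PhyloTree↔PhyloOn ∣ S ∣) ↔-refl)
                       (Σ-↔ (PhyloOn-embed S) (λ {X} → HighVertex-relabel (embed S) i (proj₁ X))))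
      where open SubsetEmbedding using (embed)
    Fin-m⋆u↔ : Fin ((m ⋆ u) n) ↔ MarkedChild i
    Fin-m⋆u↔ = ↔-trans
      (Fin-splitSum↔Σ n _ _ (λ S → ↔-trans *↔× (Fin-m↔Marked S ×-↔ ↔-trans (Fin-u↔ ∣ ∁ S ∣) (ForestOn-embed k₀ (∁ S)))))
      (↔-sym (MarkedChild↔Σ i))
    Fin-r↔HighRoot : Fin (r n) ↔ HighRootTree i
    Fin-r↔HighRoot = ↔-trans (Fin-r↔ n) (Σ-↔ (PhyloTree↔PhyloOn n) ↔-refl)
    Fin-m↔Fin-r+m⋆u : Fin (m n) ↔ Fin (r n + (m ⋆ u) n)
    Fin-m↔Fin-r+m⋆u = ↔-trans (Fin-m↔ n) (↔-trans (Σ-↔ (PhyloTree↔PhyloOn n) ↔-refl)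
      (↔-trans (MarkedTree↔⊎ i) (↔-sym (↔-trans +↔⊎ (Fin-r↔HighRoot ⊎-↔ Fin-m⋆u↔)))))

  countingIdentity : ∀ i (t m r : ℕ → ℕ) → (∀ n → Fin (t n) ↔ PhyloTree k n) →
                     (∀ n → Fin (m n) ↔ RankVertex i k n) → (∀ n → Fin (r n) ↔ RankRoot i k n) →
                     Σ (ℕ → ℕ) (λ u → (∀ l → k₀ ! * u l ≡ (t ⋆^ k₀) l) × (∀ n → m n ≡ (m ⋆ u) n + r n))
  countingIdentity i t m r Fin-t↔ Fin-m↔ Fin-r↔ =
    proj₁ (forestCount Fin-t↔ k₀) , proj₂ (proj₂ (forestCount Fin-t↔ k₀)) , vertexCount i t m r Fin-t↔ Fin-m↔ Fin-r↔


open import Data.Nat using (suc; s≤s)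
open ExponentialGeneratingFunctions using (egf-recurrence)

mainTheorem4 : (k i : ℕ) → 2 ≤ k →
    (t m r : ℕ → ℕ) →
    (∀ n → Fin (t n) ↔ PhyloTree k n) →
    (∀ n → Fin (m n) ↔ RankVertex i k n) →
    (∀ n → Fin (r n) ↔ RankRoot i k n) →
    ∀ n → egf m n ≡ ((egf m ⊛ divFact (k ∸ 1) (egf t ^ps (k ∸ 1))) ⊕ egf r) n
mainTheorem4 (suc (suc k₁)) i (s≤s (s≤s _)) t m r Fin-t↔ Fin-m↔ Fin-r↔ =
  egf-recurrence (suc k₁) t m r (RootDecomposition.countingIdentity (suc k₁) i t m r Fin-t↔ Fin-m↔ Fin-r↔)
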